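{- In $\mathsf{IdCox}_\beta(W^{\mathsf{BC}}_n)$, with notation as in the context, \[ \prod_{i=-\infty}^0 B^{(\beta)}(x_i)\prod_{i=1}^{n-1}A^{(\beta)}_i(x_i) = \prod_{j=-\infty}^0 \Big( h^{(\beta)}_0(x_j) \prod_{i=1}^{n-1}h^{(\beta)}_i(x_{i+j} \oplus x_j)\Big) \] and \[ \prod_{i=-\infty}^0 C^{(\beta)}(x_i)\prod_{i=1}^{n-1}A^{(\beta)}_i(x_i) = \prod_{j=-\infty}^0 \prod_{i=0}^{n-1} h^{(\beta)}_i(x_{i+j}\oplus x_j). \]
   Context: Fix $n\ge1$; let $R$ be a commutative ring containing $\mathbb{Z}[[x_i:i<n]]$ and fix $\beta\in R$; $x\oplus y=x+y+\beta xy$. For $0<i<n$ let $t_i=t_{ -i}=(i,i+1)(-i,-i-1)$, $t_0=(-1,1)$, and $W^{\mathsf{BC}}_n=\langle t_0,\dots,t_{n-1}\rangle$ (Coxeter group, simple generators $t_0,\dots,t_{n-1}$, length $\ell$). $\mathsf{IdCox}_\beta(W^{\mathsf{BC}}_n)$ is the free $R$-module with basis $\pi_w$ and multiplication $\pi_v\pi_w=\pi_{vw}$ if $\ell(vw)=\ell(v)+\ell(w)$, $\pi_s^2=\beta\pi_s$ for simple $s$. Write $\pi_i=\pi_{t_i}$ and $h^{(\beta)}_i(x)=1+x\pi_i$ for $-n<i<n$. Let $A^{(\beta)}_i(x)=h^{(\beta)}_{n-1}(x)\cdots h^{(\beta)}_i(x)$ ($1\le i<n$), $B^{(\beta)}(x)=h^{(\beta)}_{n-1}(x)\cdots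 h^{(\beta)}_1(x)h^{(\beta)}_0(x)h^{(\beta)}_{ -1}(x)\cdots h^{(\beta)}_{ -n+1}(x)$, $C^{(\beta)}(x)=h^{(\beta)}_{n-1}(x)\cdots h^{(\beta)}_1(x)h^{(\beta)}_0(x)h^{(\beta)}_0(x)h^{(\beta)}_{ -1}(x)\cdots h^{(\beta)}_{ -n+1}(x)$. Finite products $\prod_{i=a}^bF_i=F_a\cdots F_b$; $\prod_{j=-\infty}^0F_j=\lim_{N\to\infty}F_{ -N}\cdots F_0$, coefficientwise in the formal power series topology. -}

module Defs where

-- Concrete model of IdCox_β(W^BC_n) over ℤ[β][x_i : i ∈ ℤ] (β generic),
-- sufficient to describe the finite truncations of the infinite products.

open import Data.Nat as ℕ using (ℕ; zero; suc; _∸_; _≡ᵇ_)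
open import Data.Integer as ℤ using (ℤ; +_; -_; _≤?_)
open import Data.List using (List; []; _∷_; _++_; map; foldl; foldr; concatMap; upTo; reverse)
open import Data.Bool.ListAction using (any)
open import Data.List.Properties using (≡-dec)
open import Data.Bool using (Bool; true; false; if_then_else_; _∧_)
open import Data.Product using (_×_; _,_)
open import Relation.Nullary.Decidable using (⌊_⌋)

-- sorted insertion of a variable index into a monomial (a monomial is the
-- sorted multiset of indices of its variables)
insertℤ : ℤ → List ℤ → List ℤ
insertℤ a [] = a ∷ []
insertℤ a (b ∷ l) = if ⌊ a ≤? b ⌋ then a ∷ b ∷ l else b ∷ insertℤ a l

sortℤ : List ℤ → List ℤ
sortℤ = foldr insertℤ []

_≟L_ : (u v : List ℤ) → Bool
u ≟L v = ⌊ ≡-dec ℤ._≟_ u v ⌋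

-- Signed permutations w of {±1,…,±n}, stored as the list [w(1),…,w(n)].
idPerm : ℕ → List ℤ
idPerm n = map (λ k → + suc k) (upTo n)

negHead : List ℤ → List ℤ
negHead [] = []
negHead (a ∷ l) = (- a) ∷ l

-- swap 0-based positions k and k+1
swapAt : ℕ → List ℤ → List ℤ
swapAt zero (a ∷ b ∷ l) = b ∷ a ∷ l
swapAt zero l = l
swapAt (suc k) [] = []
swapAt (suc k) (a ∷ l) = a ∷ swapAt k l

-- right multiplication w ↦ w t_s   (t_0 = (-1,1), t_i = (i,i+1)(-i,-i-1))
rmul : List ℤ → ℕ → List ℤ
rmul w zero = negHead w
rmul w (suc i) = swapAt i w

words : ℕ → ℕ → List (List ℕ)
words n zero = [] ∷ []
words n (suc k) = concatMap (λ u → map (λ s → s ∷ u) (upTo n)) (words n k)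

evalWord : ℕ → List ℕ → List ℤ
evalWord n u = foldl rmul (idPerm n) u

-- Coxeter length: least k such that w is a product of k simple generators
-- (search up to n*n, the length of the longest element of W^BC_n)
lenSearch : ℕ → ℕ → ℕ → List ℤ → ℕ
lenSearch n k zero w = k
lenSearch n k (suc f) w =
  if any (λ u → evalWord n u ≟L w) (words n k) then k else lenSearch n (suc k) f w

len : ℕ → List ℤ → ℕ
len n w = lenSearch n 0 (n ℕ.* n) w

-- a term  c · β^b · (monomial) · π_w
record Term : Set where
  constructor term
  field
    coef : ℤ
    bpow : ℕ
    mon  : List ℤ
    perm : List ℤ
open Term public

-- elements of the algebra (finite formal sums of terms)
Elem : Set
Elem = List Term

-- polynomials in ℤ[β][x]: (coefficient, β-power, sorted monomial)
Poly : Set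
Poly = List (ℤ × ℕ × List ℤ)

var : ℤ → Poly
var j = (+ 1 , 0 , j ∷ []) ∷ []

-- x_a ⊕ x_b = x_a + x_b + β x_a x_b
oplus : ℤ → ℤ → Poly
oplus a b = var a ++ var b ++ ((+ 1 , 1 , insertℤ a (b ∷ [])) ∷ [])

-- π_w π_s = π_{ws} if ℓ(ws) = ℓ(w)+1, and = β π_w otherwise
mulGen : ℕ → Term → ℕ → Term
mulGen n (term c b m w) s =
  if len n (rmul w s) ≡ᵇ suc (len n w)
  then term c b m (rmul w s)
  else term c (suc b) m w

scale : Term → ℤ × ℕ × List ℤ → Term
scale (term c b m w) (c' , b' , m') = term (c ℤ.* c') (b ℕ.+ b') (foldr insertℤ m m') w

-- E · h_s(f) = E · (1 + f π_s)
mulH : ℕ → Elem → ℕ × Poly → Elem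
mulH n E (s , f) = E ++ concatMap (λ t → map (λ p → mulGen n (scale t p) s) f) E

-- ordered product h_{s₁}(f₁) h_{s₂}(f₂) ⋯ (a generator index s stands for t_s = t_{-s})
prodH : ℕ → List (ℕ × Poly) → Elem
prodH n fs = foldl (mulH n) (term (+ 1) 0 [] (idPerm n) ∷ []) fs

coeff : Elem → ℕ → List ℤ → List ℤ → ℤ
coeff E k m w = foldr (λ t acc →
  if (bpow t ≡ᵇ k) ∧ (mon t ≟L sortℤ m) ∧ (perm t ≟L w) then coef t ℤ.+ acc else acc)
  (+ 0) E

asc : ℕ → List ℕ
asc n = map suc (upTo (n ∸ 1))

desc : ℕ → List ℕ
desc n = reverse (asc n)

range : ℕ → List ℤ
range N = map (λ t → (+ t) ℤ.- (+ N)) (upTo (suc N))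

Bgens Cgens : ℕ → List ℕ
Bgens n = desc n ++ 0 ∷ asc n
Cgens n = desc n ++ 0 ∷ 0 ∷ asc n

Agens : ℕ → ℕ → List ℕ
Agens n i = map (λ t → n ∸ 1 ∸ t) (upTo (n ∸ i))

withVar : ℤ → List ℕ → List (ℕ × Poly)
withVar x = map (λ s → s , var x)

Apart : ℕ → List (ℕ × Poly)
Apart n = concatMap (λ i → withVar (+ i) (Agens n i)) (asc n)

-- truncations at depth N of the four infinite products
lhsB lhsC rhsB rhsC : ℕ → ℕ → Elem
lhsB n N = prodH n (concatMap (λ j → withVar j (Bgens n)) (range N) ++ Apart n)
lhsC n N = prodH n (concatMap (λ j → withVar j (Cgens n)) (range N) ++ Apart n)
rhsB n N = prodH n (concatMap (λ j → (0 , var j) ∷ map (λ i → i , oplus ((+ i) ℤ.+ j) j) (asc n)) (range N))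
rhsC n N = prodH n (concatMap (λ j → map (λ i → i , oplus ((+ i) ℤ.+ j) j) (upTo n)) (range N))

module Submission where

open import Defs
open import Data.Nat using (ℕ; _≤_)
open import Data.Integer using (ℤ)
open import Data.List using (List)
open import Data.Product using (Σ; _×_)
open import Relation.Binary.PropositionalEquality using (_≡_)

open import Data.Nat using (suc)
open import Data.Product using (_,_)

-- Write n = m + 1. On a window w reachable from the identity, the Coxeter length `len`, found
-- by exhaustive search, equals the type-B inversion number, so π_s acts on the terms
-- c β^b x^μ π_w as in the 0-Hecke monoid: π_s² = β π_s, distant generators commute, and
-- π_i, π_{i+1} braid. Hence h_s(a) h_s(b) = h_s(a ⊕ b), distant h's commute, and the
-- Yang–Baxter relation h_i(a) h_{i+1}(a ⊕ b) h_i(b) = h_{i+1}(b) h_i(a ⊕ b) h_{i+1}(a) holds.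
-- With these, the block B(x_j) (or C(x_j)) passes through ∏_i A_i(x_{i+j}), becoming the j-th
-- factor of the right-hand side and leaving ∏_i A_i(x_{i+j-1}) behind. Doing this for
-- j = 0, -1, …, -N shows that the N-th truncation of the left-hand side is ∏_i A_i(x_{i-N-1})
-- times the N-th truncation of the right-hand side, up to reordering of terms. Every term
-- contributed by that leftover product, or by the block added in passing from N to N + 1 on
-- the right, contains some x_i with i ≤ m - N - 1, so the coefficient of a fixed monomial no
-- longer changes once all its variables lie above m - N - 1.

module Monomials where

  open import Data.Integer as ℤ using (ℤ; +_)
  import Data.Integer.Properties as ℤ
  open import Data.List using (List; []; _∷_; _++_; foldr)
  import Data.List.Properties as List
  open import Data.List.Relation.Binary.Permutation.Propositional as ↭ using (_↭_; ↭-refl; ↭-trans; ↭-prep; ↭-reflexive)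
  import Data.List.Relation.Binary.Permutation.Propositional.Properties as ↭
  open import Data.List.Relation.Binary.Pointwise using (Pointwise-≡⇒≡)
  open import Data.List.Sort.InsertionSort.Base ℤ.≤-decTotalOrder using (insert)
  import Data.List.Sort.InsertionSort.Properties ℤ.≤-decTotalOrder as Insert
  open import Data.Nat as ℕ using (ℕ; suc; _+_)
  import Data.Nat.Properties as ℕ
  open import Data.Product using (_×_; _,_)
  import Algebra.Properties.CommutativeSemigroup ℤ.*-commutativeSemigroup as ℤ*
  import Algebra.Properties.CommutativeSemigroup ℕ.+-commutativeSemigroup as ℕ+
  open import Relation.Binary.PropositionalEquality
  open import Relation.Nullary using (yes; no)
  open import Function using (_∘_)

  insertℤ≡insert : ∀ a l → insertℤ a l ≡ insert a l
  insertℤ≡insert a [] = refl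
  insertℤ≡insert a (b ∷ l) with a ℤ.≤? b
  ... | yes _ = refl
  ... | no _ = cong (b ∷_) (insertℤ≡insert a l)

  insertℤ-↭ : ∀ a l → insertℤ a l ↭ a ∷ l
  insertℤ-↭ a l = subst (_↭ a ∷ l) (sym (insertℤ≡insert a l)) (Insert.insert-↭ a l)

  insertℤ-comm : ∀ a b l → insertℤ a (insertℤ b l) ≡ insertℤ b (insertℤ a l)
  insertℤ-comm a b l = begin
    insertℤ a (insertℤ b l) ≡⟨ insertℤ²≡insert² a b ⟩
    insert a (insert b l)   ≡⟨ Pointwise-≡⇒≡ (Insert.insert-swap a b l) ⟩
    insert b (insert a l)   ≡⟨ insertℤ²≡insert² b a ⟨
    insertℤ b (insertℤ a l) ∎
    where
    open ≡-Reasoning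
    insertℤ²≡insert² : ∀ a b → insertℤ a (insertℤ b l) ≡ insert a (insert b l)
    insertℤ²≡insert² a b = trans (insertℤ≡insert a (insertℤ b l)) (cong (insert a) (insertℤ≡insert b l))

  insertAll : List ℤ → List ℤ → List ℤ
  insertAll m l = foldr insertℤ m l

  insertAll-↭ : ∀ m l → insertAll m l ↭ l ++ m
  insertAll-↭ m [] = ↭-refl
  insertAll-↭ m (a ∷ l) = ↭-trans (insertℤ-↭ a (insertAll m l)) (↭-prep a (insertAll-↭ m l))

  sortℤ-↭ : ∀ l → sortℤ l ↭ l
  sortℤ-↭ l = ↭-trans (insertAll-↭ [] l) (↭-reflexive (List.++-identityʳ l))

  insertAll-resp-↭ : ∀ m {l l′} → l ↭ l′ → insertAll m l ≡ insertAll m l′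
  insertAll-resp-↭ m ↭.refl = refl
  insertAll-resp-↭ m (↭.prep a p) = cong (insertℤ a) (insertAll-resp-↭ m p)
  insertAll-resp-↭ m (↭.swap {xs = l} a b p) =
    trans (insertℤ-comm a b (insertAll m l)) (cong (insertℤ b ∘ insertℤ a) (insertAll-resp-↭ m p))
  insertAll-resp-↭ m (↭.trans p q) = trans (insertAll-resp-↭ m p) (insertAll-resp-↭ m q)

  insertAll-comm : ∀ m l l′ → insertAll (insertAll m l) l′ ≡ insertAll (insertAll m l′) l
  insertAll-comm m l l′ = begin
    insertAll (insertAll m l) l′ ≡⟨ List.foldr-++ insertℤ m l′ l ⟨
    insertAll m (l′ ++ l)        ≡⟨ insertAll-resp-↭ m (↭.++-comm l′ l) ⟩
    insertAll m (l ++ l′)        ≡⟨ List.foldr-++ insertℤ m l l′ ⟩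
    insertAll (insertAll m l′) l ∎
    where open ≡-Reasoning

  insertAll-pair : ∀ m a b → insertAll m (insertℤ a (b ∷ [])) ≡ insertℤ b (insertℤ a m)
  insertAll-pair m a b = insertAll-resp-↭ m (↭-trans (insertℤ-↭ a (b ∷ [])) (↭.↭-swap a b ↭-refl))

  β* : Term → Term
  β* (term c b m w) = term c (suc b) m w

  term-cong : ∀ {c c′ b b′ m m′ w} → c ≡ c′ → b ≡ b′ → m ≡ m′ → term c b m w ≡ term c′ b′ m′ w
  term-cong refl refl refl = refl

  scale-comm : ∀ t p q → scale (scale t p) q ≡ scale (scale t q) p
  scale-comm (term c b m w) (c₁ , b₁ , m₁) (c₂ , b₂ , m₂) =
    term-cong (ℤ*.xy∙z≈xz∙y c c₁ c₂) (ℕ+.xy∙z≈xz∙y b b₁ b₂) (insertAll-comm m m₁ m₂)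

  monomial : ℤ → ℤ × ℕ × List ℤ
  monomial a = (+ 1 , 0 , a ∷ [])

  βmonomial : ℤ → ℤ → ℤ × ℕ × List ℤ
  βmonomial a b = (+ 1 , 1 , insertℤ a (b ∷ []))

  βmonomial-comm : ∀ a b → βmonomial a b ≡ βmonomial b a
  βmonomial-comm a b = cong (λ m → (+ 1 , 1 , m)) (insertℤ-comm a b [])

  β*-scale² : ∀ t a b → β* (scale (scale t (monomial a)) (monomial b)) ≡ scale t (βmonomial a b)
  β*-scale² (term c k m w) a b = term-cong (ℤ.*-identityʳ (c ℤ.* + 1))
    (trans (cong suc (trans (ℕ.+-identityʳ (k + 0)) (ℕ.+-identityʳ k))) (ℕ.+-comm 1 k))
    (sym (insertAll-pair m a b))

  scale³-swap : ∀ u p q r → scale (scale (scale u p) q) r ≡ scale (scale (scale u r) q) p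
  scale³-swap u p q r = begin
    scale (scale (scale u p) q) r   ≡⟨ cong (λ v → scale v r) (scale-comm u p q) ⟩
    scale (scale (scale u q) p) r   ≡⟨ scale-comm (scale u q) p r ⟩
    scale (scale (scale u q) r) p   ≡⟨ cong (λ v → scale v p) (scale-comm u q r) ⟩
    scale (scale (scale u r) q) p   ∎
    where open ≡-Reasoning

module SignedPermutations where

  open import Data.Bool using (Bool; true; false; not; if_then_else_; T)
  open import Data.Bool.ListAction using (any)
  import Data.Bool.Properties as Bool
  open import Data.Empty using (⊥-elim)
  open import Data.Integer as ℤ using (ℤ; +_; -_; ∣_∣; 0ℤ)
  import Data.Integer.Properties as ℤ
  open import Data.List using (List; []; _∷_; _++_; map; foldl; length; upTo)
  import Data.List.Properties as List
  open import Data.List.Membership.Propositional using (_∈_; find)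
  import Data.List.Membership.Propositional.Properties as ∈
  open import Data.List.Relation.Binary.Permutation.Propositional
    using (_↭_; ↭-refl; ↭-sym; ↭-trans; ↭-prep; ↭-swap; ↭-reflexive; ↭⇒↭ₛ)
  import Data.List.Relation.Binary.Permutation.Propositional.Properties as ↭
  open import Data.List.Relation.Binary.Pointwise using (Pointwise-≡⇒≡)
  open import Data.List.Relation.Unary.All as All using (All; []; _∷_)
  import Data.List.Relation.Unary.All.Properties as All
  open import Data.List.Relation.Unary.Unique.Propositional using (Unique)
  open import Data.List.Relation.Unary.AllPairs as AllPairs using (AllPairs; _∷_)
  import Data.List.Relation.Unary.AllPairs.Properties as AllPairs
  open import Data.List.Relation.Unary.Any as Any using (here)
  import Data.List.Relation.Unary.Any.Properties as Any
  open import Data.List.Relation.Unary.Linked as Linked using (Linked; []; [-]; _∷_)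
  import Data.List.Relation.Unary.Linked.Properties as Linked
  import Data.List.Relation.Unary.Sorted.TotalOrder.Properties as Sorted
  open import Data.Nat as ℕ using (ℕ; zero; suc; _+_; _*_; _≤_; _<_; z≤n; s≤s; _≡ᵇ_)
  import Data.Nat.Properties as ℕ
  open import Data.Nat.Solver using (module +-*-Solver)
  open import Data.Product using (Σ; _×_; _,_; map₁; map₂)
  open import Data.Sum using (_⊎_; inj₁; inj₂)
  open import Function using (_∘_; _$_)
  open import Function.Bundles using (Equivalence)
  open import Algebra.Properties.CommutativeSemigroup ℕ.+-commutativeSemigroup using (x∙yz≈y∙xz)
  open import Relation.Binary.Definitions using (tri<; tri≈; tri>)
  open import Relation.Binary.PropositionalEquality
  open import Relation.Nullary using (¬_; yes; no; does)
  open import Relation.Nullary.Decidable using (dec-true; dec-false; toWitness; fromWitness)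

  infix 4 _<ᵇ_

  -- Opaque, so that rewriting with facts about one comparison also reaches inside
  -- definitions that branch on it.
  opaque
    _<ᵇ_ : ℤ → ℤ → Bool
    a <ᵇ b = does (a ℤ.<? b)

    <ᵇ-true : ∀ {a b} → a ℤ.< b → (a <ᵇ b) ≡ true
    <ᵇ-true {a} {b} = dec-true (a ℤ.<? b)

    <ᵇ-false : ∀ {a b} → ¬ a ℤ.< b → (a <ᵇ b) ≡ false
    <ᵇ-false {a} {b} = dec-false (a ℤ.<? b)

    <ᵇ-sound : ∀ {a b} → (a <ᵇ b) ≡ true → a ℤ.< b
    <ᵇ-sound {a} {b} e with a ℤ.<? b
    ... | yes a<b = a<b
    <ᵇ-sound () | no _

  <ᵇ-flip : ∀ {a b} → a ≢ b → (b <ᵇ a) ≡ not (a <ᵇ b)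
  <ᵇ-flip {a} {b} a≢b with ℤ.<-cmp a b
  ... | tri< a<b _ _ = trans (<ᵇ-false (ℤ.<-asym a<b)) (cong not (sym (<ᵇ-true a<b)))
  ... | tri≈ _ a≡b _ = ⊥-elim (a≢b a≡b)
  ... | tri> _ _ b<a = trans (<ᵇ-true b<a) (cong not (sym (<ᵇ-false (ℤ.<-asym b<a))))

  <ᵇ-false⇒≮ : ∀ {a b} → (a <ᵇ b) ≡ false → ¬ a ℤ.< b
  <ᵇ-false⇒≮ a≮b a<b with trans (sym (<ᵇ-true a<b)) a≮b
  ... | ()

  <ᵇ-false-flip : ∀ {a b} → a ≢ b → (a <ᵇ b) ≡ false → b ℤ.< a
  <ᵇ-false-flip {a} {b} a≢b a≮b = <ᵇ-sound (trans (<ᵇ-flip a≢b) (cong not a≮b))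

  <ᵇ-asym : ∀ {a b} → (a <ᵇ b) ≡ true → (b <ᵇ a) ≡ false
  <ᵇ-asym a<b = <ᵇ-false (ℤ.<-asym (<ᵇ-sound a<b))

  <-neg-flip : ∀ {a b} → b ℤ.< - a → a ℤ.< - b
  <-neg-flip {a} {b} p = subst (ℤ._< - b) (ℤ.neg-involutive a) (ℤ.neg-mono-< p)

  <ᵇ-neg-comm : ∀ a b → (b <ᵇ - a) ≡ (a <ᵇ - b)
  <ᵇ-neg-comm a b with b <ᵇ - a in b<-a | a <ᵇ - b in a<-b
  ... | true | true = refl
  ... | false | false = refl
  ... | true | false = trans (sym (<ᵇ-true (<-neg-flip (<ᵇ-sound b<-a)))) a<-b
  ... | false | true = trans (sym b<-a) (<ᵇ-true (<-neg-flip (<ᵇ-sound a<-b)))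

  bit : Bool → ℕ
  bit true = 1
  bit false = 0

  countBelow : ℤ → List ℤ → ℕ
  countBelow a [] = 0
  countBelow a (b ∷ l) = bit (b <ᵇ a) + countBelow a l

  headInversions : ℤ → List ℤ → ℕ
  headInversions a l = bit (a <ᵇ 0ℤ) + countBelow a l + countBelow (- a) l

  -- The Coxeter length of W^BC_n in window notation: negative entries, inversions, and pairs
  -- i < j with w(j) < -w(i).
  inversions : List ℤ → ℕ
  inversions [] = 0
  inversions (a ∷ l) = headInversions a l + inversions l

  absℤ : ℤ → ℤ
  absℤ a = + ∣ a ∣

  -- A window of a signed permutation: its entries have distinct nonzero absolute values.
  record WellFormed (w : List ℤ) : Set where
    constructor wellFormed
    field unique : Unique (map absℤ (0ℤ ∷ w))

  wellFormed-tail : ∀ {a l} → WellFormed (a ∷ l) → WellFormed l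
  wellFormed-tail (wellFormed ((_ ∷ 0∉l) ∷ _ ∷ l-unique)) = wellFormed (0∉l ∷ l-unique)

  wellFormed-nonzero : ∀ {a l} → WellFormed (a ∷ l) → a ≢ 0ℤ
  wellFormed-nonzero (wellFormed ((0≢a ∷ _) ∷ _)) refl = 0≢a refl

  wellFormed-≢ : ∀ {a b l} → WellFormed (a ∷ b ∷ l) → a ≢ b
  wellFormed-≢ (wellFormed (_ ∷ (a≢b ∷ _) ∷ _)) refl = a≢b refl

  adjacentAscent : ℕ → List ℤ → Bool
  adjacentAscent zero (a ∷ b ∷ l) = a <ᵇ b
  adjacentAscent zero _ = false
  adjacentAscent (suc k) [] = false
  adjacentAscent (suc k) (a ∷ l) = adjacentAscent k l

  -- Reading w as the window [0, w(1), …, w(n)], the simple reflection t_s is an ascent iff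
  -- the entries at positions s and s+1 increase.
  isAscent : ℕ → List ℤ → Bool
  isAscent s w = adjacentAscent s (0ℤ ∷ w)

  -- How the inversion number changes from w to w′ = w t_s, indexed by whether s is an ascent;
  -- `fixed` is the junk case of a window too short for t_s to act.
  data InversionChange (w w′ : List ℤ) : Bool → Set where
    up    : inversions w′ ≡ suc (inversions w) → InversionChange w w′ true
    down  : suc (inversions w′) ≡ inversions w → InversionChange w w′ false
    fixed : w′ ≡ w → InversionChange w w′ false

  InversionChange-cons : ∀ {b} a {l l′} → headInversions a l′ ≡ headInversions a l →
    InversionChange l l′ b → InversionChange (a ∷ l) (a ∷ l′) b
  InversionChange-cons a {l} {l′} eq (up e) = up (begin
    headInversions a l′ + inversions l′       ≡⟨ cong₂ _+_ eq e ⟩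
    headInversions a l + suc (inversions l)   ≡⟨ ℕ.+-suc _ _ ⟩
    suc (headInversions a l + inversions l)   ∎)
    where open ≡-Reasoning
  InversionChange-cons a {l} {l′} eq (down e) = down (begin
    suc (headInversions a l′ + inversions l′) ≡⟨ ℕ.+-suc _ _ ⟨
    headInversions a l′ + suc (inversions l′) ≡⟨ cong₂ _+_ eq e ⟩
    headInversions a l + inversions l         ∎)
    where open ≡-Reasoning
  InversionChange-cons a eq (fixed e) = fixed (cong (a ∷_) e)

  countBelow-swapAt : ∀ x k l → countBelow x (swapAt k l) ≡ countBelow x l
  countBelow-swapAt x zero [] = refl
  countBelow-swapAt x zero (a ∷ []) = refl
  countBelow-swapAt x zero (a ∷ b ∷ l) = x∙yz≈y∙xz (bit (b <ᵇ x)) (bit (a <ᵇ x)) (countBelow x l)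
  countBelow-swapAt x (suc k) [] = refl
  countBelow-swapAt x (suc k) (a ∷ l) = cong (bit (a <ᵇ x) ℕ.+_) (countBelow-swapAt x k l)

  headInversions-swapAt : ∀ a k l → headInversions a (swapAt k l) ≡ headInversions a l
  headInversions-swapAt a k l =
    cong₂ (λ p q → bit (a <ᵇ 0ℤ) + p + q) (countBelow-swapAt a k l) (countBelow-swapAt (- a) k l)

  -- All inversions of a ∷ b ∷ l except the one between a and b; symmetric in a and b.
  pairRest : ℤ → ℤ → List ℤ → ℕ
  pairRest a b l = bit (a <ᵇ 0ℤ) + bit (b <ᵇ 0ℤ) + bit (b <ᵇ - a)
    + countBelow a l + countBelow (- a) l + countBelow b l + countBelow (- b) l + inversions l

  inversions-pair : ∀ a b l → inversions (a ∷ b ∷ l) ≡ bit (b <ᵇ a) + pairRest a b l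
  inversions-pair a b l = solve 9
    (λ A X C N D B E F I → A :+ (X :+ C) :+ (N :+ D) :+ (B :+ E :+ F :+ I)
                        := X :+ (A :+ B :+ N :+ C :+ D :+ E :+ F :+ I))
    refl (bit (a <ᵇ 0ℤ)) (bit (b <ᵇ a)) (countBelow a l) (bit (b <ᵇ - a)) (countBelow (- a) l)
         (bit (b <ᵇ 0ℤ)) (countBelow b l) (countBelow (- b) l) (inversions l)
    where open +-*-Solver

  pairRest-comm : ∀ a b l → pairRest a b l ≡ pairRest b a l
  pairRest-comm a b l rewrite <ᵇ-neg-comm a b = solve 8
    (λ A B N C D E F I → A :+ B :+ N :+ C :+ D :+ E :+ F :+ I := B :+ A :+ N :+ E :+ F :+ C :+ D :+ I)
    refl (bit (a <ᵇ 0ℤ)) (bit (b <ᵇ 0ℤ)) (bit (a <ᵇ - b)) (countBelow a l) (countBelow (- a) l)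
         (countBelow b l) (countBelow (- b) l) (inversions l)
    where open +-*-Solver

  inversions-swap : ∀ a b l → WellFormed (a ∷ b ∷ l) → InversionChange (a ∷ b ∷ l) (b ∷ a ∷ l) (a <ᵇ b)
  inversions-swap a b l wf with ℤ.<-cmp a b
  ... | tri< a<b _ _ rewrite <ᵇ-true a<b = up (begin
    inversions (b ∷ a ∷ l)        ≡⟨ inversions-pair b a l ⟩
    bit (a <ᵇ b) + pairRest b a l ≡⟨ cong₂ (λ x r → bit x + r) (<ᵇ-true a<b) (pairRest-comm b a l) ⟩
    suc (pairRest a b l)          ≡⟨ cong (λ x → suc (bit x + pairRest a b l)) (<ᵇ-false (ℤ.<-asym a<b)) ⟨
    suc (bit (b <ᵇ a) + pairRest a b l) ≡⟨ cong suc (inversions-pair a b l) ⟨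
    suc (inversions (a ∷ b ∷ l))  ∎)
    where open ≡-Reasoning
  ... | tri≈ _ a≡b _ = ⊥-elim (wellFormed-≢ wf a≡b)
  ... | tri> _ _ b<a rewrite <ᵇ-false (ℤ.<-asym b<a) = down (begin
    suc (inversions (b ∷ a ∷ l))  ≡⟨ cong suc (inversions-pair b a l) ⟩
    suc (bit (a <ᵇ b) + pairRest b a l)
      ≡⟨ cong₂ (λ x r → suc (bit x + r)) (<ᵇ-false (ℤ.<-asym b<a)) (pairRest-comm b a l) ⟩
    suc (pairRest a b l)          ≡⟨ cong (λ x → bit x + pairRest a b l) (<ᵇ-true b<a) ⟨
    bit (b <ᵇ a) + pairRest a b l ≡⟨ inversions-pair a b l ⟨
    inversions (a ∷ b ∷ l)        ∎)
    where open ≡-Reasoning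

  inversions-swapAt : ∀ k w → WellFormed w → InversionChange w (swapAt k w) (adjacentAscent k w)
  inversions-swapAt zero [] _ = fixed refl
  inversions-swapAt zero (a ∷ []) _ = fixed refl
  inversions-swapAt zero (a ∷ b ∷ l) wf = inversions-swap a b l wf
  inversions-swapAt (suc k) [] _ = fixed refl
  inversions-swapAt (suc k) (a ∷ l) wf =
    InversionChange-cons a (headInversions-swapAt a k l) (inversions-swapAt k l (wellFormed-tail wf))

  inversions-negate : ∀ a l →
    inversions (- a ∷ l) ≡ bit (- a <ᵇ 0ℤ) + (countBelow a l + countBelow (- a) l + inversions l)
  inversions-negate a l rewrite ℤ.neg-involutive a = solve 4
    (λ X D C I → X :+ D :+ C :+ I := X :+ (C :+ D :+ I))
    refl (bit (- a <ᵇ 0ℤ)) (countBelow (- a) l) (countBelow a l) (inversions l)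
    where open +-*-Solver

  inversions-unfold : ∀ a l → inversions (a ∷ l) ≡ bit (a <ᵇ 0ℤ) + (countBelow a l + countBelow (- a) l + inversions l)
  inversions-unfold a l = solve 4
    (λ X C D I → X :+ C :+ D :+ I := X :+ (C :+ D :+ I))
    refl (bit (a <ᵇ 0ℤ)) (countBelow a l) (countBelow (- a) l) (inversions l)
    where open +-*-Solver

  inversions-negHead : ∀ w → WellFormed w → InversionChange w (negHead w) (isAscent 0 w)
  inversions-negHead [] _ = fixed refl
  inversions-negHead (a ∷ l) wf with ℤ.<-cmp 0ℤ a
  ... | tri< 0<a _ _ rewrite <ᵇ-true 0<a = up (begin
    inversions (- a ∷ l) ≡⟨ inversions-negate a l ⟩
    bit (- a <ᵇ 0ℤ) + R  ≡⟨ cong (λ x → bit x + R) (<ᵇ-true (ℤ.neg-mono-< 0<a)) ⟩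
    suc R                ≡⟨ cong (λ x → suc (bit x + R)) (<ᵇ-false (ℤ.<-asym 0<a)) ⟨
    suc (bit (a <ᵇ 0ℤ) + R) ≡⟨ cong suc (inversions-unfold a l) ⟨
    suc (inversions (a ∷ l)) ∎)
    where
    open ≡-Reasoning
    R = countBelow a l + countBelow (- a) l + inversions l
  ... | tri≈ _ 0≡a _ = ⊥-elim (wellFormed-nonzero wf (sym 0≡a))
  ... | tri> _ _ a<0 rewrite <ᵇ-false (ℤ.<-asym a<0) = down (begin
    suc (inversions (- a ∷ l)) ≡⟨ cong suc (inversions-negate a l) ⟩
    suc (bit (- a <ᵇ 0ℤ) + R)  ≡⟨ cong (λ x → suc (bit x + R)) (<ᵇ-false (ℤ.<-asym (ℤ.neg-mono-< a<0))) ⟩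
    suc R                      ≡⟨ cong (λ x → bit x + R) (<ᵇ-true a<0) ⟨
    bit (a <ᵇ 0ℤ) + R          ≡⟨ inversions-unfold a l ⟨
    inversions (a ∷ l)         ∎)
    where
    open ≡-Reasoning
    R = countBelow a l + countBelow (- a) l + inversions l

  inversions-rmul : ∀ s w → WellFormed w → InversionChange w (rmul w s) (isAscent s w)
  inversions-rmul zero w = inversions-negHead w
  inversions-rmul (suc k) w = inversions-swapAt k w

  data Reachable (n : ℕ) : List ℤ → Set where
    base : Reachable n (idPerm n)
    step : ∀ {w} → Reachable n w → ∀ s → Reachable n (rmul w s)

  absℤ-rmul : ∀ w s → map absℤ (rmul w s) ↭ map absℤ w
  absℤ-rmul [] zero = ↭-refl
  absℤ-rmul (a ∷ l) zero = ↭-reflexive (cong (λ k → + k ∷ map absℤ l) (ℤ.∣-i∣≡∣i∣ a))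
  absℤ-rmul w (suc k) = ↭.map⁺ absℤ (swapAt-↭ k w)
    where
    swapAt-↭ : ∀ k w → swapAt k w ↭ w
    swapAt-↭ zero [] = ↭-refl
    swapAt-↭ zero (a ∷ []) = ↭-refl
    swapAt-↭ zero (a ∷ b ∷ l) = ↭-swap b a ↭-refl
    swapAt-↭ (suc k) [] = ↭-refl
    swapAt-↭ (suc k) (a ∷ l) = ↭-prep a (swapAt-↭ k l)

  absℤ-reachable : ∀ {n w} → Reachable n w → map absℤ w ↭ idPerm n
  absℤ-reachable {n} base = ↭-reflexive (sym (List.map-∘ (upTo n)))
  absℤ-reachable (step {w} r s) = ↭-trans (absℤ-rmul w s) (absℤ-reachable r)

  idPerm-increasing : ∀ n → AllPairs ℤ._<_ (0ℤ ∷ idPerm n)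
  idPerm-increasing n =
    All.map⁺ (All.applyUpTo⁺₁ id n (λ _ → ℤ.+<+ (s≤s z≤n))) ∷
    AllPairs.map⁺ (AllPairs.applyUpTo⁺₁ id n (λ i<j _ → ℤ.+<+ (s≤s i<j)))
    where open Function using (id)

  wellFormed-reachable : ∀ {n w} → Reachable n w → WellFormed w
  wellFormed-reachable {n} r = wellFormed $ ↭ₛ.Unique-resp-↭ (↭⇒↭ₛ (↭-sym (↭-prep 0ℤ (absℤ-reachable r))))
    (AllPairs.map ℤ.<⇒≢ (idPerm-increasing n))
    where import Data.List.Relation.Binary.Permutation.Setoid.Properties (setoid ℤ) as ↭ₛ

  length-reachable : ∀ {n w} → Reachable n w → length w ≡ n
  length-reachable {n} {w} r = begin
    length w                ≡⟨ List.length-map absℤ w ⟨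
    length (map absℤ w)     ≡⟨ ↭.↭-length (absℤ-reachable r) ⟩
    length (idPerm n)       ≡⟨ List.length-map _ (upTo n) ⟩
    length (upTo n)         ≡⟨ List.length-upTo n ⟩
    n                       ∎
    where open ≡-Reasoning

  increasing-reachable⇒idPerm : ∀ {n w} → Reachable n w → AllPairs ℤ._<_ (0ℤ ∷ w) → w ≡ idPerm n
  increasing-reachable⇒idPerm {n} {w} r (0<w ∷ w↗) =
    Pointwise-≡⇒≡ (Sorted.↗↭↗⇒≋ ℤ.≤-totalOrder (sorted w↗) (sorted idPerm↗) (↭⇒↭ₛ w↭id))
    where
    idPerm↗ : AllPairs ℤ._<_ (idPerm n)
    idPerm↗ with idPerm-increasing n
    ... | _ ∷ ↗ = ↗
    sorted : ∀ {v} → AllPairs ℤ._<_ v → Linked ℤ._≤_ v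
    sorted v↗ = Linked.map ℤ.<⇒≤ (Linked.AllPairs⇒Linked v↗)
    absℤ-positive : ∀ v → All (0ℤ ℤ.<_) v → map absℤ v ≡ v
    absℤ-positive [] [] = refl
    absℤ-positive (a ∷ v) (0<a ∷ 0<v) = cong₂ _∷_ (ℤ.0≤i⇒+∣i∣≡i (ℤ.<⇒≤ 0<a)) (absℤ-positive v 0<v)
    w↭id : w ↭ idPerm n
    w↭id = subst (_↭ idPerm n) (absℤ-positive w 0<w) (absℤ-reachable r)

  countBelow-≡0 : ∀ x l → All (x ℤ.≤_) l → countBelow x l ≡ 0
  countBelow-≡0 x [] [] = refl
  countBelow-≡0 x (b ∷ l) (x≤b ∷ x≤l) rewrite <ᵇ-false (ℤ.≤⇒≯ x≤b) = countBelow-≡0 x l x≤l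

  inversions-increasing : ∀ w → AllPairs ℤ._<_ (0ℤ ∷ w) → inversions w ≡ 0
  inversions-increasing [] _ = refl
  inversions-increasing (a ∷ l) ((0<a ∷ 0<l) ∷ a<l ∷ l↗)
    rewrite <ᵇ-false (ℤ.<-asym 0<a)
          | countBelow-≡0 a l (All.map ℤ.<⇒≤ a<l)
          | countBelow-≡0 (- a) l (All.map (λ 0<b → ℤ.<⇒≤ (ℤ.<-trans (ℤ.neg-mono-< 0<a) 0<b)) 0<l)
    = inversions-increasing l (0<l ∷ l↗)

  inversions-idPerm : ∀ n → inversions (idPerm n) ≡ 0
  inversions-idPerm n = inversions-increasing (idPerm n) (idPerm-increasing n)

  descent-or-increasing : ∀ v → (Σ ℕ λ k → suc k < length v × adjacentAscent k v ≡ false) ⊎ Linked ℤ._<_ v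
  descent-or-increasing [] = inj₂ []
  descent-or-increasing (a ∷ []) = inj₂ [-]
  descent-or-increasing (a ∷ b ∷ l) with a <ᵇ b in a<ᵇb | descent-or-increasing (b ∷ l)
  ... | false | _ = inj₁ (0 , s≤s (s≤s z≤n) , a<ᵇb)
  ... | true | inj₁ (k , k< , e) = inj₁ (suc k , s≤s k< , e)
  ... | true | inj₂ b∷l↗ = inj₂ (<ᵇ-sound a<ᵇb ∷ b∷l↗)

  neg-≢ : ∀ {a} → a ≢ 0ℤ → - a ≢ a
  neg-≢ {+ zero} a≢0 _ = a≢0 refl
  neg-≢ {ℤ.+[1+ n ]} _ ()
  neg-≢ {ℤ.-[1+ n ]} _ ()

  swapAt-≢ : ∀ k w → WellFormed w → suc k < length w → swapAt k w ≢ w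
  swapAt-≢ zero (a ∷ []) _ (s≤s ())
  swapAt-≢ zero (a ∷ b ∷ l) wf _ e = wellFormed-≢ wf (sym (List.∷-injectiveˡ e))
  swapAt-≢ (suc k) (a ∷ l) wf (s≤s k<) e = swapAt-≢ k l (wellFormed-tail wf) k< (List.∷-injectiveʳ e)

  rmul-≢ : ∀ s w → WellFormed w → s < length w → rmul w s ≢ w
  rmul-≢ zero (a ∷ l) wf _ e = neg-≢ (wellFormed-nonzero wf) (List.∷-injectiveˡ e)
  rmul-≢ (suc k) w wf s< = swapAt-≢ k w wf s<

  Descent : ℕ → List ℤ → Set
  Descent s w = suc (inversions (rmul w s)) ≡ inversions w

  descent-or-idPerm : ∀ {n w} → Reachable n w → (Σ ℕ λ s → s < n × Descent s w) ⊎ w ≡ idPerm n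
  descent-or-idPerm {n} {w} r with descent-or-increasing (0ℤ ∷ w)
  ... | inj₂ 0∷w↗ = inj₂ (increasing-reachable⇒idPerm r (Linked.Linked⇒AllPairs ℤ.<-trans 0∷w↗))
  ... | inj₁ (s , s≤ , not-up) with subst (InversionChange w (rmul w s)) not-up (inversions-rmul s w (wellFormed-reachable r))
  ...   | down d = inj₁ (s , subst (s <_) (length-reachable r) (ℕ.s≤s⁻¹ s≤) , d)
  ...   | fixed e = ⊥-elim (rmul-≢ s w (wellFormed-reachable r) (ℕ.s≤s⁻¹ s≤) e)

  rmul-involutive : ∀ w s → rmul (rmul w s) s ≡ w
  rmul-involutive [] zero = refl
  rmul-involutive (a ∷ l) zero = cong (_∷ l) (ℤ.neg-involutive a)
  rmul-involutive w (suc k) = swapAt-involutive k w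
    where
    swapAt-involutive : ∀ k w → swapAt k (swapAt k w) ≡ w
    swapAt-involutive zero [] = refl
    swapAt-involutive zero (a ∷ []) = refl
    swapAt-involutive zero (a ∷ b ∷ l) = refl
    swapAt-involutive (suc k) [] = refl
    swapAt-involutive (suc k) (a ∷ l) = cong (a ∷_) (swapAt-involutive k l)

  ReducedWord : ℕ → List ℤ → Set
  ReducedWord n w = Σ (List ℕ) λ u → All (_< n) u × length u ≡ inversions w × evalWord n u ≡ w

  reducedWord : ∀ {n w} → Reachable n w → ReducedWord n w
  reducedWord r = go _ r refl
    where
    go : ∀ {n w} k → Reachable n w → inversions w ≡ k → ReducedWord n w
    go k r inv≡k with descent-or-idPerm r
    go {n} k r inv≡k | inj₂ refl = [] , [] , sym (inversions-idPerm n) , refl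
    go zero r inv≡0 | inj₁ (s , _ , d) = ⊥-elim (ℕ.1+n≢0 (trans d inv≡0))
    go {n} {w} (suc k) r inv≡k | inj₁ (s , s<n , d) with go k (step r s) (ℕ.suc-injective (trans d inv≡k))
    ... | u , u<n , |u| , u↦ = u ++ s ∷ [] , All.++⁺ u<n (s<n ∷ []) , |u++s| , u++s↦
      where
      |u++s| : length (u ++ s ∷ []) ≡ inversions w
      |u++s| = trans (List.length-++ u) (trans (ℕ.+-comm (length u) 1) (trans (cong suc |u|) d))
      u++s↦ : evalWord n (u ++ s ∷ []) ≡ w
      u++s↦ = trans (List.foldl-++ rmul (idPerm n) u (s ∷ [])) (trans (cong (λ v → rmul v s) u↦) (rmul-involutive w s))

  inversions-rmul-≤ : ∀ s w → WellFormed w → inversions (rmul w s) ≤ suc (inversions w)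
  inversions-rmul-≤ s w wf with isAscent s w | inversions-rmul s w wf
  ... | true | up e = ℕ.≤-reflexive e
  ... | false | down e = ℕ.≤-trans (ℕ.n≤1+n _) (ℕ.≤-trans (ℕ.≤-reflexive e) (ℕ.n≤1+n _))
  ... | false | fixed e = ℕ.≤-trans (ℕ.≤-reflexive (cong inversions e)) (ℕ.n≤1+n _)

  inversions-evalWord : ∀ n u → inversions (evalWord n u) ≤ length u
  inversions-evalWord n u = subst (λ i → inversions (evalWord n u) ≤ i + length u) (inversions-idPerm n) (go u base)
    where
    go : ∀ {w} u → Reachable n w → inversions (foldl rmul w u) ≤ inversions w + length u
    go {w} [] r = ℕ.m≤m+n (inversions w) 0
    go {w} (s ∷ u) r = begin
      inversions (foldl rmul (rmul w s) u)      ≤⟨ go u (step r s) ⟩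
      inversions (rmul w s) + length u
        ≤⟨ ℕ.+-monoˡ-≤ (length u) (inversions-rmul-≤ s w (wellFormed-reachable r)) ⟩
      suc (inversions w) + length u             ≡⟨ ℕ.+-suc (inversions w) (length u) ⟨
      inversions w + length (s ∷ u)             ∎
      where open ℕ.≤-Reasoning

  countBelow-≤ : ∀ x l → countBelow x l ≤ length l
  countBelow-≤ x [] = z≤n
  countBelow-≤ x (b ∷ l) with b <ᵇ x
  ... | true = s≤s (countBelow-≤ x l)
  ... | false = ℕ.m≤n⇒m≤1+n (countBelow-≤ x l)

  inversions-≤ : ∀ w → inversions w ≤ length w * length w
  inversions-≤ [] = z≤n
  inversions-≤ (a ∷ l) = begin
    bit (a <ᵇ 0ℤ) + countBelow a l + countBelow (- a) l + inversions l
      ≤⟨ ℕ.+-mono-≤ (ℕ.+-mono-≤ (ℕ.+-mono-≤ (bit-≤ (a <ᵇ 0ℤ)) (countBelow-≤ a l)) (countBelow-≤ (- a) l))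
                    (inversions-≤ l) ⟩
    1 + L + L + L * L
      ≡⟨ solve 1 (λ L → con 1 :+ L :+ L :+ L :* L := (con 1 :+ L) :* (con 1 :+ L)) refl L ⟩
    suc L * suc L ∎
    where
    open ℕ.≤-Reasoning
    open +-*-Solver
    L = length l
    bit-≤ : ∀ b → bit b ≤ 1
    bit-≤ true = s≤s z≤n
    bit-≤ false = z≤n

  words-length : ∀ n k u → u ∈ words n k → length u ≡ k
  words-length n zero u (here refl) = refl
  words-length n (suc k) u u∈ with ∈.∈-concat⁻′ (map (λ u → map (_∷ u) (upTo n)) (words n k)) u∈
  ... | ys , u∈ys , ys∈ with ∈.∈-map⁻ (λ u → map (_∷ u) (upTo n)) ys∈
  ...   | v , v∈ , refl with ∈.∈-map⁻ (_∷ v) u∈ys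
  ...     | s , _ , refl = cong suc (words-length n k v v∈)

  ∈-words : ∀ n u → All (_< n) u → u ∈ words n (length u)
  ∈-words n [] [] = here refl
  ∈-words n (s ∷ u) (s<n ∷ u<n) =
    ∈.∈-concat⁺′ (∈.∈-map⁺ (_∷ u) (∈.∈-upTo⁺ s<n))
                 (∈.∈-map⁺ (λ u → map (_∷ u) (upTo n)) (∈-words n u u<n))

  len≡inversions : ∀ {n w} → Reachable n w → len n w ≡ inversions w
  len≡inversions {n} {w} r =
    search (n * n) 0 z≤n (subst (λ k → inversions w ≤ k * k) (length-reachable r) (inversions-≤ w))
    where
    found : List ℕ → Bool
    found u = evalWord n u ≟L w
    found-sound : ∀ u → T (found u) → evalWord n u ≡ w
    found-sound u = toWitness {a? = List.≡-dec ℤ._≟_ (evalWord n u) w}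
    found-complete : ∀ u → evalWord n u ≡ w → T (found u)
    found-complete u = fromWitness {a? = List.≡-dec ℤ._≟_ (evalWord n u) w}
    search : ∀ fuel k → k ≤ inversions w → inversions w ≤ k + fuel → lenSearch n k fuel w ≡ inversions w
    search zero k k≤ ≤k = ℕ.≤-antisym k≤ (subst (inversions w ≤_) (ℕ.+-identityʳ k) ≤k)
    search (suc fuel) k k≤ ≤k with any found (words n k) in any-found
    ... | true with find (Any.any⁻ found (words n k) (subst T (sym any-found) _))
    ...   | u , u∈ , u↦ = ℕ.≤-antisym k≤ (begin
      inversions w              ≡⟨ cong inversions (found-sound u u↦) ⟨
      inversions (evalWord n u) ≤⟨ inversions-evalWord n u ⟩
      length u                  ≡⟨ words-length n k u u∈ ⟩
      k                         ∎)
      where open ℕ.≤-Reasoning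
    search (suc fuel) k k≤ ≤k | false with ℕ.m≤n⇒m<n∨m≡n k≤
    ... | inj₁ k< = search fuel (suc k) k< (subst (inversions w ≤_) (ℕ.+-suc k fuel) ≤k)
    ... | inj₂ refl with reducedWord r
    ...   | u , u<n , |u| , u↦ = ⊥-elim (subst T any-found (Any.any⁺ found u∈))
      where
      u∈ : Any.Any (T ∘ found) (words n (inversions w))
      u∈ = Any.map (λ { refl → found-complete u u↦ }) (subst (λ k → u ∈ words n k) |u| (∈-words n u u<n))

  ≡ᵇ-true : ∀ {m n} → m ≡ n → (m ≡ᵇ n) ≡ true
  ≡ᵇ-true {m} {n} e = Equivalence.to Bool.T-≡ (ℕ.≡⇒≡ᵇ m n e)

  ≡ᵇ-false : ∀ {m n} → m ≢ n → (m ≡ᵇ n) ≡ false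
  ≡ᵇ-false {m} {n} m≢n = Bool.¬-not (λ e → m≢n (ℕ.≡ᵇ⇒≡ m n (Equivalence.from Bool.T-≡ e)))

  lengthTest≡isAscent : ∀ {n w} → Reachable n w → ∀ s → (len n (rmul w s) ≡ᵇ suc (len n w)) ≡ isAscent s w
  lengthTest≡isAscent {n} {w} r s rewrite len≡inversions r | len≡inversions (step r s)
    with isAscent s w | inversions-rmul s w (wellFormed-reachable r)
  ... | true | up e = ≡ᵇ-true e
  ... | false | down e = ≡ᵇ-false (λ e′ → ℕ.m≢1+n+m (inversions w) (trans (sym e) (cong suc e′)))
  ... | false | fixed e = ≡ᵇ-false (λ e′ → ℕ.1+n≢n (trans (sym e′) (cong inversions e)))

  isAscent-rmul : ∀ s w → isAscent s w ≡ true → isAscent s (rmul w s) ≡ false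
  isAscent-rmul zero (a ∷ l) 0<ᵇa = <ᵇ-false (ℤ.<-asym (ℤ.neg-mono-< (<ᵇ-sound 0<ᵇa)))
  isAscent-rmul (suc k) w = adjacentAscent-swapAt k w
    where
    adjacentAscent-swapAt : ∀ k w → adjacentAscent k w ≡ true → adjacentAscent k (swapAt k w) ≡ false
    adjacentAscent-swapAt zero (a ∷ b ∷ l) a<ᵇb = <ᵇ-false (ℤ.<-asym (<ᵇ-sound a<ᵇb))
    adjacentAscent-swapAt (suc k) (a ∷ l) = adjacentAscent-swapAt k l

  swapAt-comm : ∀ {i j} w → suc i < j → swapAt j (swapAt i w) ≡ swapAt i (swapAt j w)
  swapAt-comm {zero} {suc zero} _ (s≤s ())
  swapAt-comm {zero} {suc (suc j)} [] _ = refl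
  swapAt-comm {zero} {suc (suc j)} (a ∷ []) _ = refl
  swapAt-comm {zero} {suc (suc j)} (a ∷ b ∷ l) _ = refl
  swapAt-comm {suc i} {suc j} [] _ = refl
  swapAt-comm {suc i} {suc j} (a ∷ l) (s≤s i<j) = cong (a ∷_) (swapAt-comm l i<j)

  adjacentAscent-swapAtˡ : ∀ {i j} w → suc i < j → adjacentAscent j (swapAt i w) ≡ adjacentAscent j w
  adjacentAscent-swapAtˡ {zero} {suc zero} _ (s≤s ())
  adjacentAscent-swapAtˡ {zero} {suc (suc j)} [] _ = refl
  adjacentAscent-swapAtˡ {zero} {suc (suc j)} (a ∷ []) _ = refl
  adjacentAscent-swapAtˡ {zero} {suc (suc j)} (a ∷ b ∷ l) _ = refl
  adjacentAscent-swapAtˡ {suc i} {suc j} [] _ = refl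
  adjacentAscent-swapAtˡ {suc i} {suc j} (a ∷ l) (s≤s i<j) = adjacentAscent-swapAtˡ l i<j

  adjacentAscent-swapAtʳ : ∀ {i j} w → suc i < j → adjacentAscent i (swapAt j w) ≡ adjacentAscent i w
  adjacentAscent-swapAtʳ {zero} {suc zero} _ (s≤s ())
  adjacentAscent-swapAtʳ {zero} {suc (suc j)} [] _ = refl
  adjacentAscent-swapAtʳ {zero} {suc (suc j)} (a ∷ []) _ = refl
  adjacentAscent-swapAtʳ {zero} {suc (suc j)} (a ∷ b ∷ l) _ = refl
  adjacentAscent-swapAtʳ {suc i} {suc j} [] _ = refl
  adjacentAscent-swapAtʳ {suc i} {suc j} (a ∷ l) (s≤s i<j) = adjacentAscent-swapAtʳ l i<j

  rmul-comm : ∀ {s s′} w → suc s < s′ → rmul (rmul w s) s′ ≡ rmul (rmul w s′) s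
  rmul-comm {zero} {suc zero} _ (s≤s ())
  rmul-comm {zero} {suc (suc k)} [] _ = refl
  rmul-comm {zero} {suc (suc k)} (a ∷ l) _ = refl
  rmul-comm {suc i} {suc j} w (s≤s i<j) = swapAt-comm w i<j

  isAscent-rmulˡ : ∀ {s s′} w → suc s < s′ → isAscent s′ (rmul w s) ≡ isAscent s′ w
  isAscent-rmulˡ {zero} {suc zero} _ (s≤s ())
  isAscent-rmulˡ {zero} {suc (suc k)} [] _ = refl
  isAscent-rmulˡ {zero} {suc (suc k)} (a ∷ l) _ = refl
  isAscent-rmulˡ {suc i} {suc j} w (s≤s i<j) = adjacentAscent-swapAtˡ w i<j

  isAscent-rmulʳ : ∀ {s s′} w → suc s < s′ → isAscent s (rmul w s′) ≡ isAscent s w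
  isAscent-rmulʳ {zero} {suc zero} _ (s≤s ())
  isAscent-rmulʳ {zero} {suc (suc k)} [] _ = refl
  isAscent-rmulʳ {zero} {suc (suc k)} (a ∷ l) _ = refl
  isAscent-rmulʳ {suc i} {suc j} w (s≤s i<j) = adjacentAscent-swapAtʳ w i<j

  -- The action of π_s on β^b π_w, recorded as the pair (b, w).
  πStep : ℕ → ℕ × List ℤ → ℕ × List ℤ
  πStep s (b , w) = if isAscent s w then (b , rmul w s) else (suc b , w)

  πStep-idem : ∀ s b w → πStep s (πStep s (b , w)) ≡ map₁ suc (πStep s (b , w))
  πStep-idem s b w with isAscent s w in asc
  ... | true rewrite isAscent-rmul s w asc = refl
  ... | false rewrite asc = refl

  πStep-comm : ∀ {s s′} b w → suc s < s′ → πStep s′ (πStep s (b , w)) ≡ πStep s (πStep s′ (b , w))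
  πStep-comm {s} {s′} b w far with isAscent s w in asc | isAscent s′ w in asc′
  ... | true  | true  rewrite isAscent-rmulˡ w far | isAscent-rmulʳ w far | asc | asc′ | rmul-comm w far = refl
  ... | true  | false rewrite isAscent-rmulˡ w far | asc′ | asc = refl
  ... | false | true  rewrite isAscent-rmulʳ w far | asc | asc′ = refl
  ... | false | false rewrite asc | asc′ = refl

  πStep-braid₀ : ∀ b x y z l → x ≢ y → y ≢ z →
    πStep 1 (πStep 2 (πStep 1 (b , x ∷ y ∷ z ∷ l))) ≡ πStep 2 (πStep 1 (πStep 2 (b , x ∷ y ∷ z ∷ l)))
  πStep-braid₀ b x y z l x≢y y≢z = cases (x <ᵇ y) (x <ᵇ z) (y <ᵇ z) refl refl refl
    where
    cases : ∀ p q r → (x <ᵇ y) ≡ p → (x <ᵇ z) ≡ q → (y <ᵇ z) ≡ r →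
      πStep 1 (πStep 2 (πStep 1 (b , x ∷ y ∷ z ∷ l))) ≡ πStep 2 (πStep 1 (πStep 2 (b , x ∷ y ∷ z ∷ l)))
    -- Each rewrite only reaches the comparisons exposed so far, hence the repetitions.
    cases true  true  true  x<y x<z y<z rewrite x<y | x<z | y<z | x<z | x<y = refl
    cases true  true  false x<y x<z y≮z rewrite x<y | x<z | y≮z | x<y | x<z = refl
    cases true  false true  x<y x≮z y<z = ⊥-elim (<ᵇ-false⇒≮ x≮z (ℤ.<-trans (<ᵇ-sound x<y) (<ᵇ-sound y<z)))
    cases true  false false x<y x≮z y≮z rewrite x<y | x≮z | <ᵇ-asym x<y | y≮z | x<y | x≮z = refl
    cases false true  true  x≮y x<z y<z rewrite x≮y | y<z | x<z | x≮y = refl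
    cases false true  false x≮y x<z y≮z =
      ⊥-elim (ℤ.<-asym (<ᵇ-sound x<z) (ℤ.<-trans (<ᵇ-false-flip y≢z y≮z) (<ᵇ-false-flip x≢y x≮y)))
    cases false false true  x≮y x≮z y<z rewrite x≮y | y<z | x≮z | <ᵇ-asym y<z = refl
    cases false false false x≮y _   y≮z rewrite x≮y | y≮z | x≮y | y≮z = refl

  πStep-cons : ∀ k a p → πStep (suc (suc k)) (map₂ (a ∷_) p) ≡ map₂ (a ∷_) (πStep (suc k) p)
  πStep-cons k a (b , l) with adjacentAscent k l
  ... | true = refl
  ... | false = refl

  πStep-braid : ∀ k b w → WellFormed w →
      πStep (suc k) (πStep (suc (suc k)) (πStep (suc k) (b , w)))
    ≡ πStep (suc (suc k)) (πStep (suc k) (πStep (suc (suc k)) (b , w)))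
  πStep-braid zero b [] _ = refl
  πStep-braid zero b (x ∷ []) _ = refl
  πStep-braid zero b (x ∷ y ∷ []) _ with x <ᵇ y in x<y
  ... | true rewrite <ᵇ-asym x<y = refl
  ... | false rewrite x<y = refl
  πStep-braid zero b (x ∷ y ∷ z ∷ l) wf = πStep-braid₀ b x y z l (wellFormed-≢ wf) (wellFormed-≢ (wellFormed-tail wf))
  πStep-braid (suc k) b [] _ = refl
  πStep-braid (suc k) b (a ∷ l) wf =
    trans (cons³ k (suc k) k)
      (trans (cong (map₂ (a ∷_)) (πStep-braid k b l (wellFormed-tail wf))) (sym (cons³ (suc k) k (suc k))))
    where
    cons³ : ∀ i j k′ → πStep (suc (suc i)) (πStep (suc (suc j)) (πStep (suc (suc k′)) (b , a ∷ l)))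
                    ≡ map₂ (a ∷_) (πStep (suc i) (πStep (suc j) (πStep (suc k′) (b , l))))
    cons³ i j k′ = trans (cong (πStep (suc (suc i)) ∘ πStep (suc (suc j))) (πStep-cons k′ a (b , l)))
      (trans (cong (πStep (suc (suc i))) (πStep-cons j a _)) (πStep-cons i a _))

module ZeroHeckeAction (n : ℕ) where

  open Monomials
  open SignedPermutations
  open import Data.Bool using (true; false)
  open import Data.Integer as ℤ using (ℤ)
  open import Data.List using (List; []; _∷_; foldr)
  open import Data.Nat as ℕ using (suc; _<_; _≡ᵇ_)
  open import Data.Product using (_×_; _,_; proj₁; proj₂)
  open import Function using (_∘_)
  open import Relation.Binary.PropositionalEquality

  π : ℕ → Term → Term
  π s t = mulGen n t s

  ReachableTerm : Term → Set
  ReachableTerm t = Reachable n (perm t)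

  termAt : ℤ → List ℤ → ℕ × List ℤ → Term
  termAt c m p = term c (proj₁ p) m (proj₂ p)

  π-termAt : ∀ s c m p → Reachable n (proj₂ p) → π s (termAt c m p) ≡ termAt c m (πStep s p)
  π-termAt s c m (b , w) r rewrite lengthTest≡isAscent r s with isAscent s w
  ... | true = refl
  ... | false = refl

  πStep-reachable : ∀ s p → Reachable n (proj₂ p) → Reachable n (proj₂ (πStep s p))
  πStep-reachable s (b , w) r with isAscent s w
  ... | true = step r s
  ... | false = r

  π-word : ∀ ss c m p → Reachable n (proj₂ p) → foldr π (termAt c m p) ss ≡ termAt c m (foldr πStep p ss)
  π-word [] c m p r = refl
  π-word (s ∷ ss) c m p r = trans (cong (π s) (π-word ss c m p r)) (π-termAt s c m (foldr πStep p ss) (foldr-reachable ss))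
    where
    foldr-reachable : ∀ ss → Reachable n (proj₂ (foldr πStep p ss))
    foldr-reachable [] = r
    foldr-reachable (s ∷ ss) = πStep-reachable s _ (foldr-reachable ss)

  π-reachable : ∀ s t → ReachableTerm t → ReachableTerm (π s t)
  π-reachable s (term c b m w) r with len n (rmul w s) ≡ᵇ suc (len n w)
  ... | true = step r s
  ... | false = r

  π-scale : ∀ s t p → π s (scale t p) ≡ scale (π s t) p
  π-scale s (term c b m w) (c′ , b′ , m′) with len n (rmul w s) ≡ᵇ suc (len n w)
  ... | true = refl
  ... | false = refl

  π-β* : ∀ s t → π s (β* t) ≡ β* (π s t)
  π-β* s (term c b m w) with len n (rmul w s) ≡ᵇ suc (len n w)
  ... | true = refl
  ... | false = refl

  module _ {t : Term} (r : ReachableTerm t) where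
    private
      p = (bpow t , perm t)
      word : ∀ ss → foldr π t ss ≡ termAt (coef t) (mon t) (foldr πStep p ss)
      word ss = π-word ss (coef t) (mon t) p r
      word-≡ : ∀ ss ss′ → foldr πStep p ss ≡ foldr πStep p ss′ → foldr π t ss ≡ foldr π t ss′
      word-≡ ss ss′ eq = trans (word ss) (trans (cong (termAt (coef t) (mon t)) eq) (sym (word ss′)))

    π-idem : ∀ s → π s (π s t) ≡ β* (π s t)
    π-idem s = trans (word (s ∷ s ∷ []))
      (trans (cong (termAt (coef t) (mon t)) (πStep-idem s (bpow t) (perm t))) (cong β* (sym (word (s ∷ [])))))

    π-comm : ∀ {s s′} → suc s < s′ → π s′ (π s t) ≡ π s (π s′ t)
    π-comm {s} {s′} far = word-≡ (s′ ∷ s ∷ []) (s ∷ s′ ∷ []) (πStep-comm (bpow t) (perm t) far)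

    π-braid : ∀ k → π (suc k) (π (suc (suc k)) (π (suc k) t)) ≡ π (suc (suc k)) (π (suc k) (π (suc (suc k)) t))
    π-braid k = word-≡ (suc k ∷ suc (suc k) ∷ suc k ∷ []) (suc (suc k) ∷ suc k ∷ suc (suc k) ∷ [])
      (πStep-braid k (bpow t) (perm t) (wellFormed-reachable r))

  mon-π : ∀ s t → mon (π s t) ≡ mon t
  mon-π s (term c b m w) with len n (rmul w s) ≡ᵇ suc (len n w)
  ... | true = refl
  ... | false = refl

  π-merge : ∀ s t a b → ReachableTerm t →
    π s (scale (π s (scale t (monomial a))) (monomial b)) ≡ π s (scale t (βmonomial a b))
  π-merge s t a b r = begin
    π s (scale (π s (scale t (monomial a))) (monomial b)) ≡⟨ cong (π s) (π-scale s (scale t (monomial a)) (monomial b)) ⟨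
    π s (π s u)                                           ≡⟨ π-idem r s ⟩
    β* (π s u)                                            ≡⟨ π-β* s u ⟨
    π s (β* u)                                            ≡⟨ cong (π s) (β*-scale² t a b) ⟩
    π s (scale t (βmonomial a b))                         ∎
    where
    open ≡-Reasoning
    u = scale (scale t (monomial a)) (monomial b)

  π-scale-comm : ∀ {s s′} t p q → ReachableTerm t → suc s < s′ →
    π s′ (scale (π s (scale t p)) q) ≡ π s (scale (π s′ (scale t q)) p)
  π-scale-comm {s} {s′} t p q r far = begin
    π s′ (scale (π s (scale t p)) q)   ≡⟨ cong (π s′) (π-scale s (scale t p) q) ⟨
    π s′ (π s (scale (scale t p) q))   ≡⟨ π-comm r far ⟩
    π s (π s′ (scale (scale t p) q))   ≡⟨ cong (π s ∘ π s′) (scale-comm t p q) ⟩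
    π s (π s′ (scale (scale t q) p))   ≡⟨ cong (π s) (π-scale s′ (scale t q) p) ⟩
    π s (scale (π s′ (scale t q)) p)   ∎
    where open ≡-Reasoning

  π-scale-swap : ∀ s s′ u p q → π s (scale (π s′ (scale u p)) q) ≡ π s (scale (π s′ (scale u q)) p)
  π-scale-swap s s′ u p q = cong (π s) (begin
    scale (π s′ (scale u p)) q   ≡⟨ π-scale s′ (scale u p) q ⟨
    π s′ (scale (scale u p) q)   ≡⟨ cong (π s′) (scale-comm u p q) ⟩
    π s′ (scale (scale u q) p)   ≡⟨ π-scale s′ (scale u q) p ⟩
    scale (π s′ (scale u q)) p   ∎)
    where open ≡-Reasoning

  π³-scale : ∀ s₁ s₂ s₃ t p₁ p₂ p₃ →
    π s₃ (scale (π s₂ (scale (π s₁ (scale t p₁)) p₂)) p₃) ≡ scale (scale (scale (π s₃ (π s₂ (π s₁ t))) p₁) p₂) p₃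
  π³-scale s₁ s₂ s₃ t p₁ p₂ p₃ = begin
    π s₃ (scale (π s₂ (scale (π s₁ (scale t p₁)) p₂)) p₃)   ≡⟨ cong (λ u → π s₃ (scale (π s₂ (scale u p₂)) p₃)) (π-scale s₁ t p₁) ⟩
    π s₃ (scale (π s₂ (scale (scale u₁ p₁) p₂)) p₃)         ≡⟨ cong (λ u → π s₃ (scale u p₃)) (π-scale s₂ (scale u₁ p₁) p₂) ⟩
    π s₃ (scale (scale (π s₂ (scale u₁ p₁)) p₂) p₃)         ≡⟨ cong (λ u → π s₃ (scale (scale u p₂) p₃)) (π-scale s₂ u₁ p₁) ⟩
    π s₃ (scale (scale (scale u₂ p₁) p₂) p₃)                ≡⟨ π-scale s₃ _ p₃ ⟩
    scale (π s₃ (scale (scale u₂ p₁) p₂)) p₃                ≡⟨ cong (λ u → scale u p₃) (π-scale s₃ _ p₂) ⟩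
    scale (scale (π s₃ (scale u₂ p₁)) p₂) p₃                ≡⟨ cong (λ u → scale (scale u p₂) p₃) (π-scale s₃ u₂ p₁) ⟩
    scale (scale (scale (π s₃ u₂) p₁) p₂) p₃                ∎
    where
    open ≡-Reasoning
    u₁ = π s₁ t
    u₂ = π s₂ u₁

module FactorProducts (n : ℕ) where

  open Monomials
  open ZeroHeckeAction n
  import Algebra.Solver.CommutativeMonoid
  open import Data.List using (List; []; _∷_; [_]; _++_; map; foldl; concatMap)
  import Data.List.Properties as List
  open import Data.List.Relation.Binary.Permutation.Propositional as ↭ using (_↭_; ↭-refl; ↭-sym; ↭-trans; ↭-prep; ↭-swap; ↭-reflexive)
  import Data.List.Relation.Binary.Permutation.Propositional.Properties as ↭
  open import Data.List.Relation.Binary.Pointwise using (Pointwise-≡⇒≡; []; _∷_)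
  open import Data.List.Relation.Unary.All as All using (All; []; _∷_)
  import Data.List.Relation.Unary.All.Properties as All
  open import Data.Nat as ℕ using (suc; _<_)
  open import Data.Product using (_×_; _,_)
  open import Function using (_∘_)
  open import Relation.Binary.Bundles using (Setoid)
  open import Relation.Binary.PropositionalEquality using (_≡_; refl; sym; trans; cong; subst₂; module ≡-Reasoning)
  import Relation.Binary.Reasoning.Setoid as SetoidReasoning

  private
    module CM = Algebra.Solver.CommutativeMonoid (↭.++-commutativeMonoid {A = Term})

  Factor : Set
  Factor = ℕ × Poly

  product : Elem → List Factor → Elem
  product E hs = foldl (mulH n) E hs

  πScaled : ℕ → Poly → Term → Elem
  πScaled s f t = map (λ p → π s (scale t p)) f

  concatMap-↭ : ∀ (f : Term → Elem) {E F} → E ↭ F → concatMap f E ↭ concatMap f F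
  concatMap-↭ f ↭.refl = ↭-refl
  concatMap-↭ f (↭.prep x p) = ↭.++⁺ˡ (f x) (concatMap-↭ f p)
  concatMap-↭ f (↭.swap x y p) = ↭-trans (↭.shifts (f x) (f y)) (↭.++⁺ˡ (f y) (↭.++⁺ˡ (f x) (concatMap-↭ f p)))
  concatMap-↭ f (↭.trans p q) = ↭-trans (concatMap-↭ f p) (concatMap-↭ f q)

  product-↭ : ∀ {E F} hs → E ↭ F → product E hs ↭ product F hs
  product-↭ [] p = p
  product-↭ ((s , f) ∷ hs) p = product-↭ hs (↭.++⁺ p (concatMap-↭ (πScaled s f) p))

  mulH-++ : ∀ E F h → mulH n (E ++ F) h ↭ mulH n E h ++ mulH n F h
  mulH-++ E F (s , f) = begin
    (E ++ F) ++ φ (E ++ F)     ≡⟨ cong ((E ++ F) ++_) (List.concatMap-++ (πScaled s f) E F) ⟩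
    (E ++ F) ++ φ E ++ φ F     ≡⟨ List.++-assoc E F _ ⟩
    E ++ F ++ φ E ++ φ F       ↭⟨ ↭.++⁺ˡ E (↭.shifts F (φ E)) ⟩
    E ++ φ E ++ F ++ φ F       ≡⟨ List.++-assoc E _ _ ⟨
    (E ++ φ E) ++ F ++ φ F     ∎
    where
    open ↭.PermutationReasoning
    φ = concatMap (πScaled s f)

  product-++ : ∀ E F hs → product (E ++ F) hs ↭ product E hs ++ product F hs
  product-++ E F [] = ↭-refl
  product-++ E F (h ∷ hs) = ↭-trans (product-↭ hs (mulH-++ E F h)) (product-++ (mulH n E h) (mulH n F h) hs)

  product-[] : ∀ hs → product [] hs ≡ []
  product-[] [] = refl
  product-[] (h ∷ hs) = product-[] hs

  product-termwise : ∀ E hs → product E hs ↭ concatMap (λ t → product (t ∷ []) hs) E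
  product-termwise [] hs = ↭-reflexive (product-[] hs)
  product-termwise (t ∷ E) hs =
    ↭-trans (product-++ (t ∷ []) E hs) (↭.++⁺ˡ (product (t ∷ []) hs) (product-termwise E hs))

  product-++ʳ : ∀ E hs hs′ → product E (hs ++ hs′) ≡ product (product E hs) hs′
  product-++ʳ E hs hs′ = List.foldl-++ (mulH n) E hs hs′

  All-concatMap : ∀ {P : Term → Set} (f : Term → Elem) {E} → (∀ {t} → P t → All P (f t)) →
    All P E → All P (concatMap f E)
  All-concatMap f h [] = []
  All-concatMap f h (pt ∷ pE) = All.++⁺ (h pt) (All-concatMap f h pE)

  product-reachable : ∀ E hs → All ReachableTerm E → All ReachableTerm (product E hs)
  product-reachable E [] rE = rE
  product-reachable E ((s , f) ∷ hs) rE = product-reachable (mulH n E (s , f)) hs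
    (All.++⁺ rE (All-concatMap (πScaled s f) (λ {t} → πScaled-reachable t) rE))
    where
    πScaled-reachable : ∀ t → ReachableTerm t → All ReachableTerm (πScaled s f t)
    πScaled-reachable t r = All.map⁺ (All.tabulate (λ {p} _ → π-reachable s (scale t p) r))

  infix 4 _≃_

  -- Up to reordering of terms, which coefficients cannot see.
  record _≃_ (hs hs′ : List Factor) : Set where
    constructor mk≃
    field apply : ∀ E → All ReachableTerm E → product E hs ↭ product E hs′
  open _≃_ public

  ≃-termwise : ∀ {hs hs′} → (∀ t → ReachableTerm t → product (t ∷ []) hs ↭ product (t ∷ []) hs′) → hs ≃ hs′
  ≃-termwise {hs} {hs′} h = mk≃ λ E rE → begin
    product E hs                                ↭⟨ product-termwise E hs ⟩
    concatMap (λ t → product (t ∷ []) hs) E     ↭⟨ concatMap-cong rE ⟩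
    concatMap (λ t → product (t ∷ []) hs′) E    ↭⟨ product-termwise E hs′ ⟨
    product E hs′                               ∎
    where
    open ↭.PermutationReasoning
    concatMap-cong : ∀ {E} → All ReachableTerm E →
      concatMap (λ t → product (t ∷ []) hs) E ↭ concatMap (λ t → product (t ∷ []) hs′) E
    concatMap-cong [] = ↭-refl
    concatMap-cong {t ∷ _} (r ∷ rE) = ↭.++⁺ (h t r) (concatMap-cong rE)

  ≃-refl : ∀ {hs} → hs ≃ hs
  ≃-refl = mk≃ λ _ _ → ↭-refl

  ≃-reflexive : ∀ {hs hs′} → hs ≡ hs′ → hs ≃ hs′
  ≃-reflexive refl = ≃-refl

  ≃-sym : ∀ {hs hs′} → hs ≃ hs′ → hs′ ≃ hs
  ≃-sym p = mk≃ λ E rE → ↭-sym (apply p E rE)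

  ≃-trans : ∀ {hs hs′ hs″} → hs ≃ hs′ → hs′ ≃ hs″ → hs ≃ hs″
  ≃-trans p q = mk≃ λ E rE → ↭-trans (apply p E rE) (apply q E rE)

  ≃-setoid : Setoid _ _
  ≃-setoid = record
    { Carrier = List Factor
    ; _≈_ = _≃_
    ; isEquivalence = record { refl = ≃-refl ; sym = ≃-sym ; trans = ≃-trans }
    }

  module ≃-Reasoning = SetoidReasoning ≃-setoid

  ++⁺ˡ : ∀ gs {hs hs′} → hs ≃ hs′ → gs ++ hs ≃ gs ++ hs′
  ++⁺ˡ gs {hs} {hs′} p = mk≃ λ E rE →
    subst₂ _↭_ (sym (product-++ʳ E gs hs)) (sym (product-++ʳ E gs hs′)) (apply p (product E gs) (product-reachable E gs rE))

  ++⁺ʳ : ∀ gs {hs hs′} → hs ≃ hs′ → hs ++ gs ≃ hs′ ++ gs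
  ++⁺ʳ gs {hs} {hs′} p = mk≃ λ E rE →
    subst₂ _↭_ (sym (product-++ʳ E hs gs)) (sym (product-++ʳ E hs′ gs)) (product-↭ gs (apply p E rE))

  ++⁺ : ∀ {gs gs′ hs hs′} → gs ≃ gs′ → hs ≃ hs′ → gs ++ hs ≃ gs′ ++ hs′
  ++⁺ {gs′ = gs′} {hs = hs} p q = ≃-trans (++⁺ʳ hs p) (++⁺ˡ gs′ q)

  ∷⁺ : ∀ h {hs hs′} → hs ≃ hs′ → h ∷ hs ≃ h ∷ hs′
  ∷⁺ h = ++⁺ˡ (h ∷ [])

  h-merge : ∀ s a b → (s , var a) ∷ (s , var b) ∷ [] ≃ (s , oplus a b) ∷ []
  h-merge s a b = ≃-termwise λ t r →
    ↭-reflexive (cong (λ u → t ∷ π s (scale t (monomial a)) ∷ π s (scale t (monomial b)) ∷ u ∷ [])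
                      (π-merge s t a b r))

  ⊕-comm : ∀ s a b → (s , oplus a b) ∷ [] ≃ (s , oplus b a) ∷ []
  ⊕-comm s a b = ≃-termwise λ t r →
    ↭-prep t (↭-swap _ _ (↭-reflexive (cong (λ p → π s (scale t p) ∷ []) (βmonomial-comm a b))))

  mulH-[t] : ∀ t s f → mulH n (t ∷ []) (s , f) ≡ t ∷ πScaled s f t
  mulH-[t] t s f = cong (t ∷_) (List.++-identityʳ (πScaled s f t))

  mulH-monomial : ∀ E s q → mulH n E (s , q ∷ []) ≡ E ++ map (λ u → π s (scale u q)) E
  mulH-monomial E s q = cong (E ++_) (concatMap-[q] E)
    where
    concatMap-[q] : ∀ E → concatMap (πScaled s (q ∷ [])) E ≡ map (λ u → π s (scale u q)) E
    concatMap-[q] [] = refl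
    concatMap-[q] (u ∷ E) = cong (π s (scale u q) ∷_) (concatMap-[q] E)

  h-comm : ∀ {s s′} → suc s < s′ → ∀ f q →
    (s , f) ∷ (s′ , q ∷ []) ∷ [] ≃ (s′ , q ∷ []) ∷ (s , f) ∷ []
  h-comm {s} {s′} far f q = ≃-termwise λ t r → begin
    product (t ∷ []) ((s , f) ∷ (s′ , q ∷ []) ∷ [])
      ≡⟨ cong (λ E → mulH n E (s′ , q ∷ [])) (mulH-[t] t s f) ⟩
    mulH n (t ∷ Φ t) (s′ , q ∷ [])
      ≡⟨ mulH-monomial (t ∷ Φ t) s′ q ⟩
    (t ∷ Φ t) ++ map ψ (t ∷ Φ t)
      ≡⟨ List.++-assoc (t ∷ []) (Φ t) _ ⟩
    t ∷ Φ t ++ ψ t ∷ map ψ (Φ t)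
      ↭⟨ ↭-prep t (↭.shift (ψ t) (Φ t) _) ⟩
    t ∷ ψ t ∷ Φ t ++ map ψ (Φ t)
      ≡⟨ cong (λ X → t ∷ ψ t ∷ Φ t ++ X) (ψ-πScaled t r) ⟩
    t ∷ ψ t ∷ Φ t ++ Φ (ψ t) ++ []
      ≡⟨ cong (λ E → mulH n E (s , f)) (mulH-monomial (t ∷ []) s′ q) ⟨
    product (t ∷ []) ((s′ , q ∷ []) ∷ (s , f) ∷ [])
      ∎
    where
    open ↭.PermutationReasoning
    Φ = πScaled s f
    ψ : Term → Term
    ψ u = π s′ (scale u q)
    ψ-πScaled : ∀ t → ReachableTerm t → map ψ (πScaled s f t) ≡ πScaled s f (ψ t) ++ []
    ψ-πScaled t r = trans (sym (List.map-∘ f))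
      (trans (List.map-cong (λ p → π-scale-comm t p q r far) f) (sym (List.++-identityʳ _)))

  yang-baxter : ∀ k a b → let i = suc k; j = suc (suc k) in
    (i , var a) ∷ (j , oplus a b) ∷ (i , var b) ∷ [] ≃ (j , var b) ∷ (i , oplus a b) ∷ (j , var a) ∷ []
  yang-baxter k a b = ≃-termwise λ t r → ↭-trans (regroup t) (↭-reflexive (Pointwise-≡⇒≡ (
    refl ∷ refl ∷ refl ∷ refl ∷ π-merge i t a b r ∷ F≡ t X ∷ F≡ t Y ∷ F≡ t Z ∷
    refl ∷ BZ≡ t r ∷ C≡ t X ∷ C≡ t Y ∷ C≡ t Z ∷ G≡ t r X ∷ G≡ t r Y ∷ G≡ t r Z ∷ [])))
    where
    i = suc k
    j = suc (suc k)
    X = monomial a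
    Y = monomial b
    Z = βmonomial a b
    -- The sixteen terms of the left-hand product, in the order of their counterparts on the right.
    regroup : ∀ t → let A = π i (scale t X); B = λ o → π j (scale t o); C = λ o → π j (scale A o)
                        F = λ o → π i (scale (B o) Y); G = λ o → π i (scale (C o) Y) in
      product (t ∷ []) ((i , var a) ∷ (j , oplus a b) ∷ (i , var b) ∷ []) ↭
      t ∷ B Y ∷ A ∷ π i (scale t Y) ∷ π i (scale A Y) ∷ F X ∷ F Y ∷ F Z ∷
      B X ∷ B Z ∷ C X ∷ C Y ∷ C Z ∷ G X ∷ G Y ∷ G Z ∷ []
    regroup t = CM.solve 16
      (λ t A BX BY BZ CX CY CZ D E FX FY FZ GX GY GZ →
        t ⊕ A ⊕ BX ⊕ BY ⊕ BZ ⊕ CX ⊕ CY ⊕ CZ ⊕ D ⊕ E ⊕ FX ⊕ FY ⊕ FZ ⊕ GX ⊕ GY ⊕ GZ ⊜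
        t ⊕ BY ⊕ A ⊕ D ⊕ E ⊕ FX ⊕ FY ⊕ FZ ⊕ BX ⊕ BZ ⊕ CX ⊕ CY ⊕ CZ ⊕ GX ⊕ GY ⊕ GZ)
      ↭-refl [ t ] [ A ] [ B X ] [ B Y ] [ B Z ] [ C X ] [ C Y ] [ C Z ]
             [ π i (scale t Y) ] [ π i (scale A Y) ] [ F X ] [ F Y ] [ F Z ] [ G X ] [ G Y ] [ G Z ]
      where
      open CM using (_⊕_; _⊜_)
      A = π i (scale t X)
      B = λ o → π j (scale t o)
      C = λ o → π j (scale A o)
      F = λ o → π i (scale (B o) Y)
      G = λ o → π i (scale (C o) Y)
    F≡ : ∀ t o → π i (scale (π j (scale t o)) Y) ≡ π i (scale (π j (scale t Y)) o)
    F≡ t o = π-scale-swap i j t o Y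
    C≡ : ∀ t o → π j (scale (π i (scale t X)) o) ≡ π j (scale (π i (scale t o)) X)
    C≡ t o = π-scale-swap j i t X o
    BZ≡ : ∀ t → ReachableTerm t → π j (scale t Z) ≡ π j (scale (π j (scale t Y)) X)
    BZ≡ t r = trans (cong (π j ∘ scale t) (βmonomial-comm a b)) (sym (π-merge j t b a r))
    G≡ : ∀ t → ReachableTerm t → ∀ o →
      π i (scale (π j (scale (π i (scale t X)) o)) Y) ≡ π j (scale (π i (scale (π j (scale t Y)) o)) X)
    G≡ t r o = begin
      π i (scale (π j (scale (π i (scale t X)) o)) Y)   ≡⟨ π³-scale i j i t X o Y ⟩
      scale (scale (scale (π i (π j (π i t))) X) o) Y   ≡⟨ cong (λ u → scale (scale (scale u X) o) Y) (π-braid r k) ⟩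
      scale (scale (scale (π j (π i (π j t))) X) o) Y   ≡⟨ scale³-swap (π j (π i (π j t))) X o Y ⟩
      scale (scale (scale (π j (π i (π j t))) Y) o) X   ≡⟨ π³-scale j i j t Y o X ⟨
      π j (scale (π i (scale (π j (scale t Y)) o)) X)   ∎
      where open ≡-Reasoning

module Factorisation (m : ℕ) where

  open FactorProducts (suc m)
  open import Data.Integer as ℤ using (ℤ; +_)
  open import Data.List using (List; []; _∷_; _++_; map; concatMap; reverse; applyUpTo; applyDownFrom; upTo)
  import Data.List.Properties as List
  import Data.Integer.Properties as ℤ
  open import Data.List.Relation.Unary.All as All using (All; []; _∷_)
  import Data.List.Relation.Unary.All.Properties as All
  open import Data.Nat as ℕ using (zero; _+_; _∸_; _≤_; _<_; z≤n; s≤s; pred)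
  import Data.Nat.Properties as ℕ
  open import Data.Product using (Σ; _×_; _,_; proj₁; proj₂)
  open import Function using (_∘_)
  open import Relation.Binary.PropositionalEquality

  factors : (ℕ → Factor) → ℕ → ℕ → List Factor
  factors h a zero = []
  factors h a (suc k) = h a ∷ factors h (suc a) k

  hUp : ℕ → ℕ → ℤ → List Factor
  hUp a k x = factors (λ s → s , var x) a k

  hDown : ℕ → ℕ → ℤ → List Factor
  hDown a zero x = []
  hDown a (suc k) x = hDown (suc a) k x ++ (a , var x) ∷ []

  -- A_a(y_a) ⋯ A_{a+c-1}(y_{a+c-1}), where A_i(x) = h_{a+c-1}(x) ⋯ h_i(x).
  Aprod : ℕ → ℕ → (ℕ → ℤ) → List Factor
  Aprod a zero y = []
  Aprod a (suc c) y = hDown a (suc c) (y a) ++ Aprod (suc a) c y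

  h⊕ : ℕ → ℕ → ℤ → (ℕ → ℤ) → List Factor
  h⊕ a c x y = factors (λ i → i , oplus x (y i)) a c

  IsMonomial : Factor → Set
  IsMonomial h = Σ _ λ q → proj₂ h ≡ q ∷ []

  MonomialsFrom : ℕ → List Factor → Set
  MonomialsFrom a hs = All (λ h → a ≤ proj₁ h × IsMonomial h) hs

  MonomialsFrom-weaken : ∀ {a a′ hs} → a ≤ a′ → MonomialsFrom a′ hs → MonomialsFrom a hs
  MonomialsFrom-weaken a≤a′ = All.map (λ (a′≤ , mono) → ℕ.≤-trans a≤a′ a′≤ , mono)

  h-comm-past : ∀ {s a} f hs → suc s < a → MonomialsFrom a hs → (s , f) ∷ hs ≃ hs ++ (s , f) ∷ []
  h-comm-past f [] _ [] = ≃-refl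
  h-comm-past f ((s′ , .(q ∷ [])) ∷ hs) far ((a≤s′ , q , refl) ∷ mono) =
    ≃-trans (++⁺ʳ hs (h-comm (ℕ.<-≤-trans far a≤s′) f q)) (∷⁺ (s′ , q ∷ []) (h-comm-past f hs far mono))

  hDown-monomials : ∀ a k x → MonomialsFrom a (hDown a k x)
  hDown-monomials a zero x = []
  hDown-monomials a (suc k) x =
    All.++⁺ (MonomialsFrom-weaken (ℕ.n≤1+n a) (hDown-monomials (suc a) k x)) ((ℕ.≤-refl , _ , refl) ∷ [])

  hUp-monomials : ∀ a k x → MonomialsFrom a (hUp a k x)
  hUp-monomials a zero x = []
  hUp-monomials a (suc k) x = (ℕ.≤-refl , _ , refl) ∷ MonomialsFrom-weaken (ℕ.n≤1+n a) (hUp-monomials (suc a) k x)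

  Aprod-monomials : ∀ a c y → MonomialsFrom a (Aprod a c y)
  Aprod-monomials a zero y = []
  Aprod-monomials a (suc c) y =
    All.++⁺ (hDown-monomials a (suc c) (y a)) (MonomialsFrom-weaken (ℕ.n≤1+n a) (Aprod-monomials (suc a) c y))

  hUp-hDown : ∀ a k x y → 1 ≤ a →
    hUp a (suc k) x ++ hDown a (suc k) y ≃ hDown (suc a) k y ++ (a , oplus x y) ∷ hUp (suc a) k x
  hUp-hDown a zero x y _ = h-merge a x y
  hUp-hDown (suc a′) (suc k) x y _ = begin
    (X ∷ hUp (suc a) (suc k) x) ++ (hDown (suc a) (suc k) y ++ Y ∷ [])
      ≡⟨ cong (X ∷_) (List.++-assoc (hUp (suc a) (suc k) x) (hDown (suc a) (suc k) y) (Y ∷ [])) ⟨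
    X ∷ ((hUp (suc a) (suc k) x ++ hDown (suc a) (suc k) y) ++ Y ∷ [])
      ≈⟨ ∷⁺ X (++⁺ʳ (Y ∷ []) (hUp-hDown (suc a) k x y (s≤s z≤n))) ⟩
    X ∷ ((D ++ (suc a , O) ∷ U) ++ Y ∷ [])
      ≡⟨ cong (X ∷_) (List.++-assoc D ((suc a , O) ∷ U) (Y ∷ [])) ⟩
    (X ∷ D) ++ (suc a , O) ∷ U ++ Y ∷ []
      ≈⟨ ++⁺ʳ ((suc a , O) ∷ U ++ Y ∷ []) (h-comm-past (var x) D ℕ.≤-refl (hDown-monomials _ k y)) ⟩
    (D ++ X ∷ []) ++ (suc a , O) ∷ U ++ Y ∷ []
      ≈⟨ ++⁺ˡ (D ++ X ∷ []) (∷⁺ (suc a , O) (≃-sym (h-comm-past (var y) U ℕ.≤-refl (hUp-monomials _ k x)))) ⟩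
    (D ++ X ∷ []) ++ (suc a , O) ∷ Y ∷ U
      ≡⟨ List.++-assoc D (X ∷ []) _ ⟩
    D ++ (X ∷ (suc a , O) ∷ Y ∷ []) ++ U
      ≈⟨ ++⁺ˡ D (++⁺ʳ U (yang-baxter a′ x y)) ⟩
    D ++ ((suc a , var y) ∷ (a , O) ∷ (suc a , var x) ∷ []) ++ U
      ≡⟨ List.++-assoc D ((suc a , var y) ∷ []) _ ⟨
    hDown (suc a) (suc k) y ++ (a , O) ∷ hUp (suc a) (suc k) x
      ∎
    where
    open ≃-Reasoning
    a = suc a′
    D = hDown (suc (suc a)) k y
    U = hUp (suc (suc a)) k x
    O = oplus x y
    X = (a , var x)
    Y = (a , var y)

  hUp-Aprod : ∀ k c x y → 1 ≤ k →
    hUp k (suc c) x ++ Aprod k (suc c) y ≃ Aprod (suc k) c (y ∘ pred) ++ h⊕ k (suc c) x y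
  hUp-Aprod k zero x y 1≤k = begin
    hUp k 1 x ++ hDown k 1 (y k) ++ [] ≡⟨ cong (hUp k 1 x ++_) (List.++-identityʳ (hDown k 1 (y k))) ⟩
    hUp k 1 x ++ hDown k 1 (y k)      ≈⟨ hUp-hDown k zero x (y k) 1≤k ⟩
    (k , oplus x (y k)) ∷ []           ∎
    where open ≃-Reasoning
  hUp-Aprod k (suc c′) x y 1≤k = begin
    hUp k (suc c) x ++ (hDown k (suc c) (y k) ++ Aprod (suc k) c y)
      ≡⟨ List.++-assoc (hUp k (suc c) x) _ _ ⟨
    (hUp k (suc c) x ++ hDown k (suc c) (y k)) ++ Aprod (suc k) c y
      ≈⟨ ++⁺ʳ (Aprod (suc k) c y) (hUp-hDown k c x (y k) 1≤k) ⟩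
    (D ++ O ∷ hUp (suc k) c x) ++ Aprod (suc k) c y
      ≡⟨ List.++-assoc D _ _ ⟩
    D ++ O ∷ (hUp (suc k) c x ++ Aprod (suc k) c y)
      ≈⟨ ++⁺ˡ D (∷⁺ O (hUp-Aprod (suc k) c′ x y (s≤s z≤n))) ⟩
    D ++ (O ∷ Aprod (suc (suc k)) c′ (y ∘ pred)) ++ h⊕ (suc k) c x y
      ≈⟨ ++⁺ˡ D (++⁺ʳ (h⊕ (suc k) c x y) (h-comm-past _ _ ℕ.≤-refl (Aprod-monomials _ c′ (y ∘ pred)))) ⟩
    D ++ (Aprod (suc (suc k)) c′ (y ∘ pred) ++ O ∷ []) ++ h⊕ (suc k) c x y
      ≡⟨ trans (cong (D ++_) (List.++-assoc (Aprod (suc (suc k)) c′ (y ∘ pred)) _ _)) (sym (List.++-assoc D _ _)) ⟩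
    Aprod (suc k) c (y ∘ pred) ++ h⊕ k (suc c) x y
      ∎
    where
    open ≃-Reasoning
    c = suc c′
    D = hDown (suc k) c (y k)
    O = (k , oplus x (y k))

  Aprod-cong : ∀ a c {y y′} → (∀ i → a ≤ i → y i ≡ y′ i) → Aprod a c y ≡ Aprod a c y′
  Aprod-cong a zero _ = refl
  Aprod-cong a (suc c) y≗y′ =
    cong₂ _++_ (cong (hDown a (suc c)) (y≗y′ a ℕ.≤-refl))
               (Aprod-cong (suc a) c (λ i a<i → y≗y′ i (ℕ.≤-trans (ℕ.n≤1+n a) a<i)))

  Bblock : ℕ → ℤ → Poly → List Factor
  Bblock c x z = hDown 1 c x ++ (0 , z) ∷ hUp 1 c x

  -- Moving a B-block through A_1(y_1) ⋯ A_c(y_c) shifts the arguments: y′ = (x, y_1, y_2, …).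
  Bblock-Aprod : ∀ c x z {y y′} → y′ 1 ≡ x → (∀ i → 2 ≤ i → y′ i ≡ y (pred i)) →
    Bblock c x z ++ Aprod 1 c y ≃ Aprod 1 c y′ ++ (0 , z) ∷ h⊕ 1 c x y
  Bblock-Aprod zero x z _ _ = ≃-refl
  Bblock-Aprod (suc c′) x z {y} {y′} y′₁ y′-shift = begin
    (hDown 1 c x ++ (0 , z) ∷ hUp 1 c x) ++ Aprod 1 c y
      ≡⟨ List.++-assoc (hDown 1 c x) _ _ ⟩
    hDown 1 c x ++ (0 , z) ∷ (hUp 1 c x ++ Aprod 1 c y)
      ≈⟨ ++⁺ˡ (hDown 1 c x) (∷⁺ (0 , z) (hUp-Aprod 1 c′ x y (s≤s z≤n))) ⟩
    hDown 1 c x ++ ((0 , z) ∷ Aprod 2 c′ (y ∘ pred)) ++ h⊕ 1 c x y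
      ≈⟨ ++⁺ˡ (hDown 1 c x) (++⁺ʳ (h⊕ 1 c x y) (h-comm-past z _ ℕ.≤-refl (Aprod-monomials 2 c′ (y ∘ pred)))) ⟩
    hDown 1 c x ++ (Aprod 2 c′ (y ∘ pred) ++ (0 , z) ∷ []) ++ h⊕ 1 c x y
      ≡⟨ trans (cong (hDown 1 c x ++_) (List.++-assoc (Aprod 2 c′ (y ∘ pred)) _ _)) (sym (List.++-assoc (hDown 1 c x) _ _)) ⟩
    (hDown 1 c x ++ Aprod 2 c′ (y ∘ pred)) ++ (0 , z) ∷ h⊕ 1 c x y
      ≡⟨ cong (λ hs → hs ++ (0 , z) ∷ h⊕ 1 c x y)
           (cong₂ _++_ (cong (hDown 1 c) (sym y′₁)) (Aprod-cong 2 c′ (λ i 2≤i → sym (y′-shift i 2≤i)))) ⟩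
    Aprod 1 c y′ ++ (0 , z) ∷ h⊕ 1 c x y
      ∎
    where
    open ≃-Reasoning
    c = suc c′

  applyUpTo-cong : ∀ {A : Set} {f g : ℕ → A} k → (∀ {t} → t < k → f t ≡ g t) → applyUpTo f k ≡ applyUpTo g k
  applyUpTo-cong zero f≗g = refl
  applyUpTo-cong (suc k) f≗g = cong₂ _∷_ (f≗g (s≤s z≤n)) (applyUpTo-cong k (λ t<k → f≗g (s≤s t<k)))

  applyDownFrom-applyUpTo : ∀ {A : Set} (f : ℕ → A) k → applyDownFrom f k ≡ applyUpTo (λ t → f (k ∸ suc t)) k
  applyDownFrom-applyUpTo f zero = refl
  applyDownFrom-applyUpTo f (suc k) = cong (f k ∷_) (applyDownFrom-applyUpTo f k)

  factors-applyUpTo : ∀ h a k → factors h a k ≡ applyUpTo (λ t → h (a + t)) k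
  factors-applyUpTo h a zero = refl
  factors-applyUpTo h a (suc k) = cong₂ _∷_ (cong h (sym (ℕ.+-identityʳ a)))
    (trans (factors-applyUpTo h (suc a) k) (applyUpTo-cong k (λ {t} _ → cong h (sym (ℕ.+-suc a t)))))

  hDown≡reverse-hUp : ∀ a k x → hDown a k x ≡ reverse (hUp a k x)
  hDown≡reverse-hUp a zero x = refl
  hDown≡reverse-hUp a (suc k) x =
    trans (cong (_++ (a , var x) ∷ []) (hDown≡reverse-hUp (suc a) k x))
          (sym (List.unfold-reverse (a , var x) (hUp (suc a) k x)))

  hUp-asc : ∀ x → hUp 1 m x ≡ withVar x (asc (suc m))
  hUp-asc x = trans (factors-applyUpTo _ 1 m) (sym (trans (sym (List.map-∘ (upTo m))) (List.map-upTo _ m)))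

  hDown-desc : ∀ x → hDown 1 m x ≡ withVar x (desc (suc m))
  hDown-desc x = trans (hDown≡reverse-hUp 1 m x) (trans (cong reverse (hUp-asc x)) (sym (List.reverse-map _ (asc (suc m)))))

  hDown-Agens : ∀ i k v → i + k ≡ suc m → withVar v (Agens (suc m) i) ≡ hDown i k v
  hDown-Agens i k v i+k≡n = begin
    withVar v (Agens (suc m) i)                          ≡⟨ cong (λ k′ → withVar v (map (m ∸_) (upTo k′))) k′≡k ⟩
    withVar v (map (m ∸_) (upTo k))                      ≡⟨ trans (sym (List.map-∘ (upTo k))) (List.map-upTo _ k) ⟩
    applyUpTo (λ t → m ∸ t , var v) k                    ≡⟨ applyUpTo-cong k (λ t<k → cong (_, var v) (top-index t<k)) ⟨
    applyUpTo (λ t → i + (k ∸ suc t) , var v) k          ≡⟨ applyDownFrom-applyUpTo _ k ⟨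
    applyDownFrom (λ t → i + t , var v) k                ≡⟨ List.reverse-applyUpTo _ k ⟨
    reverse (applyUpTo (λ t → i + t , var v) k)          ≡⟨ cong reverse (factors-applyUpTo _ i k) ⟨
    reverse (hUp i k v)                                  ≡⟨ hDown≡reverse-hUp i k v ⟨
    hDown i k v                                          ∎
    where
    open ≡-Reasoning
    k′≡k : suc m ∸ i ≡ k
    k′≡k = trans (cong (_∸ i) (sym i+k≡n)) (ℕ.m+n∸m≡n i k)
    top-index : ∀ {t} → t < k → i + (k ∸ suc t) ≡ m ∸ t
    top-index {t} t<k = trans (sym (ℕ.+-∸-assoc i t<k)) (cong (λ n → n ∸ suc t) i+k≡n)

  Apart≡Aprod : Apart (suc m) ≡ Aprod 1 m (ℤ.+_)
  Apart≡Aprod = trans (cong (concatMap A) (List.map-upTo suc m)) (go 1 m refl)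
    where
    A : ℕ → List Factor
    A i = withVar (+ i) (Agens (suc m) i)
    go : ∀ a c → a + c ≡ suc m → concatMap A (applyUpTo (a ℕ.+_) c) ≡ Aprod a c (ℤ.+_)
    go a zero _ = refl
    go a (suc c) a+c≡n = cong₂ _++_
      (trans (cong A (ℕ.+-identityʳ a)) (hDown-Agens a (suc c) (+ a) a+c≡n))
      (trans (cong (concatMap A) (applyUpTo-cong c (λ {t} _ → ℕ.+-suc a t)))
             (go (suc a) c (trans (sym (ℕ.+-suc a c)) a+c≡n)))

  Bgens-Bblock : ∀ j → withVar j (Bgens (suc m)) ≡ Bblock m j (var j)
  Bgens-Bblock j = trans (List.map-++ _ (desc (suc m)) (0 ∷ asc (suc m)))
    (sym (cong₂ (λ D U → D ++ (0 , var j) ∷ U) (hDown-desc j) (hUp-asc j)))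

  Cgens-Bblock : ∀ j → withVar j (Cgens (suc m)) ≃ Bblock m j (oplus j j)
  Cgens-Bblock j = ≃-trans
    (≃-reflexive (trans (List.map-++ _ (desc (suc m)) (0 ∷ 0 ∷ asc (suc m)))
      (sym (cong₂ (λ D U → D ++ (0 , var j) ∷ (0 , var j) ∷ U) (hDown-desc j) (hUp-asc j)))))
    (++⁺ˡ (hDown 1 m j) (++⁺ʳ (hUp 1 m j) (h-merge 0 j j)))

  factors-≃ : ∀ {h h′} a k → (∀ i → h i ∷ [] ≃ h′ i ∷ []) → factors h a k ≃ factors h′ a k
  factors-≃ a zero h≃h′ = ≃-refl
  factors-≃ a (suc k) h≃h′ = ++⁺ (h≃h′ a) (factors-≃ (suc a) k h≃h′)

  Y : ℤ → ℕ → ℤ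
  Y j i = + i ℤ.+ j

  rhsBlock : Poly → ℤ → List Factor
  rhsBlock z j = (0 , z) ∷ map (λ i → i , oplus (Y j i) j) (asc (suc m))

  Bblock-Aprod-Y : ∀ z j → Bblock m j z ++ Aprod 1 m (Y j) ≃ Aprod 1 m (Y (j ℤ.- + 1)) ++ rhsBlock z j
  Bblock-Aprod-Y z j = ≃-trans (Bblock-Aprod m j z (Y-pred₁ j) Y-pred)
    (++⁺ˡ (Aprod 1 m (Y (j ℤ.- + 1))) (∷⁺ (0 , z) h⊕-asc))
    where
    open import Data.Integer.Solver using (module +-*-Solver)
    open +-*-Solver
    Y-pred₁ : ∀ j → Y (j ℤ.- + 1) 1 ≡ j
    Y-pred₁ = solve 1 (λ j → con (+ 1) :+ (j :- con (+ 1)) := j) refl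
    Y-pred : ∀ i → 2 ≤ i → Y (j ℤ.- + 1) i ≡ Y j (pred i)
    Y-pred (suc zero) (s≤s ())
    Y-pred (suc (suc i)) _ =
      solve 2 (λ i j → (con (+ 1) :+ (con (+ 1) :+ i)) :+ (j :- con (+ 1)) := (con (+ 1) :+ i) :+ j) refl (+ i) j
    h⊕-asc : h⊕ 1 m j (Y j) ≃ map (λ i → i , oplus (Y j i) j) (asc (suc m))
    h⊕-asc = ≃-trans (factors-≃ 1 m (λ i → ⊕-comm i j (Y j i)))
      (≃-reflexive (trans (factors-applyUpTo _ 1 m) (sym (trans (sym (List.map-∘ (upTo m))) (List.map-upTo _ m)))))

  lowest : ℕ → ℤ
  lowest N = + 0 ℤ.- + N

  range-suc : ∀ N → range (suc N) ≡ lowest (suc N) ∷ range N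
  range-suc N = cong (lowest (suc N) ∷_) (begin
    map (λ t → + t ℤ.- + suc N) (applyUpTo suc (suc N))  ≡⟨ List.map-applyUpTo suc _ (suc N) ⟩
    applyUpTo (λ t → + suc t ℤ.- + suc N) (suc N)       ≡⟨ applyUpTo-cong (suc N) (λ {t} _ → shift t) ⟩
    applyUpTo (λ t → + t ℤ.- + N) (suc N)               ≡⟨ List.map-upTo _ (suc N) ⟨
    range N                                              ∎)
    where
    open ≡-Reasoning
    open import Data.Integer.Solver using (module +-*-Solver)
    open +-*-Solver
    shift : ∀ t → + suc t ℤ.- + suc N ≡ + t ℤ.- + N
    shift t = solve 2 (λ t N → (con (+ 1) :+ t) :- (con (+ 1) :+ N) := t :- N) refl (+ t) (+ N)

  lowest-pred : ∀ N → lowest N ℤ.- + 1 ≡ lowest (suc N)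
  lowest-pred N = solve 1 (λ N → (con (+ 0) :- N) :- con (+ 1) := con (+ 0) :- (con (+ 1) :+ N)) refl (+ N)
    where
    open import Data.Integer.Solver using (module +-*-Solver)
    open +-*-Solver

  Bblocks-Aprod : ∀ (z : ℤ → Poly) N →
    concatMap (λ j → Bblock m j (z j)) (range N) ++ Aprod 1 m (Y (+ 0)) ≃
    Aprod 1 m (Y (lowest (suc N))) ++ concatMap (λ j → rhsBlock (z j) j) (range N)
  Bblocks-Aprod z zero = begin
    (B (+ 0) ++ []) ++ Aprod 1 m (Y (+ 0))        ≡⟨ cong (_++ Aprod 1 m (Y (+ 0))) (List.++-identityʳ (B (+ 0))) ⟩
    B (+ 0) ++ Aprod 1 m (Y (+ 0))                ≈⟨ Bblock-Aprod-Y (z (+ 0)) (+ 0) ⟩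
    Aprod 1 m (Y (lowest 1)) ++ R (+ 0)           ≡⟨ cong (Aprod 1 m (Y (lowest 1)) ++_) (List.++-identityʳ (R (+ 0))) ⟨
    Aprod 1 m (Y (lowest 1)) ++ R (+ 0) ++ []     ∎
    where
    open ≃-Reasoning
    B = λ j → Bblock m j (z j)
    R = λ j → rhsBlock (z j) j
  Bblocks-Aprod z (suc N) = begin
    concatMap B (range (suc N)) ++ Aprod 1 m (Y (+ 0))
      ≡⟨ cong (λ r → concatMap B r ++ Aprod 1 m (Y (+ 0))) (range-suc N) ⟩
    (B j ++ concatMap B (range N)) ++ Aprod 1 m (Y (+ 0))
      ≡⟨ List.++-assoc (B j) _ _ ⟩
    B j ++ concatMap B (range N) ++ Aprod 1 m (Y (+ 0))
      ≈⟨ ++⁺ˡ (B j) (Bblocks-Aprod z N) ⟩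
    B j ++ Aprod 1 m (Y j) ++ concatMap R (range N)
      ≡⟨ List.++-assoc (B j) _ _ ⟨
    (B j ++ Aprod 1 m (Y j)) ++ concatMap R (range N)
      ≈⟨ ++⁺ʳ (concatMap R (range N)) (Bblock-Aprod-Y (z j) j) ⟩
    (Aprod 1 m (Y (j ℤ.- + 1)) ++ R j) ++ concatMap R (range N)
      ≡⟨ List.++-assoc (Aprod 1 m (Y (j ℤ.- + 1))) (R j) _ ⟩
    Aprod 1 m (Y (j ℤ.- + 1)) ++ concatMap R (lowest (suc N) ∷ range N)
      ≡⟨ cong₂ (λ i r → Aprod 1 m (Y i) ++ concatMap R r) (lowest-pred (suc N)) (sym (range-suc N)) ⟩
    Aprod 1 m (Y (lowest (suc (suc N)))) ++ concatMap R (range (suc N))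
      ∎
    where
    open ≃-Reasoning
    j = lowest (suc N)
    B = λ j → Bblock m j (z j)
    R = λ j → rhsBlock (z j) j

  concatMap-≃ : ∀ {F G : ℤ → List Factor} js → (∀ j → F j ≃ G j) → concatMap F js ≃ concatMap G js
  concatMap-≃ [] F≃G = ≃-refl
  concatMap-≃ (j ∷ js) F≃G = ++⁺ (F≃G j) (concatMap-≃ js F≃G)

  Apart≡Aprod-Y : Apart (suc m) ≡ Aprod 1 m (Y (+ 0))
  Apart≡Aprod-Y = trans Apart≡Aprod (Aprod-cong 1 m (λ i _ → sym (ℤ.+-identityʳ (+ i))))

  leftover : ℕ → List Factor
  leftover N = Aprod 1 m (Y (lowest (suc N)))

  rhsB-block rhsC-block : ℤ → List Factor
  rhsB-block j = (0 , var j) ∷ map (λ i → i , oplus (+ i ℤ.+ j) j) (asc (suc m))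
  rhsC-block j = map (λ i → i , oplus (+ i ℤ.+ j) j) (upTo (suc m))

  lhsB-factors lhsC-factors rhsB-factors rhsC-factors : ℕ → List Factor
  lhsB-factors N = concatMap (λ j → withVar j (Bgens (suc m))) (range N) ++ Apart (suc m)
  lhsC-factors N = concatMap (λ j → withVar j (Cgens (suc m))) (range N) ++ Apart (suc m)
  rhsB-factors N = concatMap rhsB-block (range N)
  rhsC-factors N = concatMap rhsC-block (range N)

  B-factorisation : ∀ N → lhsB-factors N ≃ leftover N ++ rhsB-factors N
  B-factorisation N = ≃-trans (≃-reflexive (cong₂ _++_ (List.concatMap-cong Bgens-Bblock (range N)) Apart≡Aprod-Y))
    (Bblocks-Aprod var N)

  C-factorisation : ∀ N → lhsC-factors N ≃ leftover N ++ rhsC-factors N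
  C-factorisation N = ≃-trans (++⁺ (concatMap-≃ (range N) Cgens-Bblock) (≃-reflexive Apart≡Aprod-Y))
    (≃-trans (Bblocks-Aprod (λ j → oplus j j) N)
             (≃-reflexive (cong (leftover N ++_) (List.concatMap-cong rhsBlock-upTo (range N)))))
    where
    rhsBlock-upTo : ∀ j → rhsBlock (oplus j j) j ≡ rhsC-block j
    rhsBlock-upTo j = cong₂ (λ x is → (0 , oplus x j) ∷ map (λ i → i , oplus (+ i ℤ.+ j) j) is)
      (sym (ℤ.+-identityˡ j)) (List.map-upTo suc m)

module Coefficients where

  open import Data.Bool using (true; false; if_then_else_; _∧_; T)
  import Data.Bool.Properties as Bool
  open import Data.Empty using (⊥; ⊥-elim)
  open import Function using (_∘_)
  open import Data.Integer as ℤ using (ℤ; +_)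
  import Data.Integer.Properties as ℤ
  open import Data.List using (List; []; _∷_; _++_; foldr)
  import Data.List.Properties as List
  open import Data.List.Relation.Binary.Permutation.Propositional as ↭ using (_↭_)
  open import Data.List.Relation.Unary.All as All using (All; []; _∷_)
  open import Data.List.Relation.Unary.Any as Any using (Any; here; there)
  open import Data.Nat using (ℕ; _≡ᵇ_)
  import Algebra.Properties.CommutativeSemigroup ℤ.+-commutativeSemigroup as ℤ+
  open import Relation.Binary.PropositionalEquality
  open import Relation.Nullary.Decidable using (toWitness)

  -- coeff E k m w = foldr (coeffStep k m w) (+ 0) E
  coeffStep : ℕ → List ℤ → List ℤ → Term → ℤ → ℤ
  coeffStep k m w t acc = if (bpow t ≡ᵇ k) ∧ (mon t ≟L sortℤ m) ∧ (perm t ≟L w) then coef t ℤ.+ acc else acc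

  coeffStep-comm : ∀ k m w t u acc → coeffStep k m w t (coeffStep k m w u acc) ≡ coeffStep k m w u (coeffStep k m w t acc)
  coeffStep-comm k m w t u acc
    with (bpow t ≡ᵇ k) ∧ (mon t ≟L sortℤ m) ∧ (perm t ≟L w)
       | (bpow u ≡ᵇ k) ∧ (mon u ≟L sortℤ m) ∧ (perm u ≟L w)
  ... | true  | true  = ℤ+.x∙yz≈y∙xz (coef t) (coef u) acc
  ... | true  | false = refl
  ... | false | true  = refl
  ... | false | false = refl

  coeff-↭ : ∀ {E F} k m w → E ↭ F → coeff E k m w ≡ coeff F k m w
  coeff-↭ k m w ↭.refl = refl
  coeff-↭ k m w (↭.prep t p) = cong (coeffStep k m w t) (coeff-↭ k m w p)
  coeff-↭ k m w (↭.swap t u p) =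
    trans (cong (coeffStep k m w t ∘ coeffStep k m w u) (coeff-↭ k m w p)) (coeffStep-comm k m w t u _)
  coeff-↭ k m w (↭.trans p q) = trans (coeff-↭ k m w p) (coeff-↭ k m w q)

  coeff-++ : ∀ E F k m w → coeff (E ++ F) k m w ≡ coeff E k m w ℤ.+ coeff F k m w
  coeff-++ E F k m w = trans (List.foldr-++ (coeffStep k m w) (+ 0) E F) (foldr-acc E (coeff F k m w))
    where
    foldr-acc : ∀ E acc → foldr (coeffStep k m w) acc E ≡ foldr (coeffStep k m w) (+ 0) E ℤ.+ acc
    foldr-acc [] acc = sym (ℤ.+-identityˡ acc)
    foldr-acc (t ∷ E) acc with (bpow t ≡ᵇ k) ∧ (mon t ≟L sortℤ m) ∧ (perm t ≟L w)
    ... | true = trans (cong (λ x → coef t ℤ.+ x) (foldr-acc E acc)) (sym (ℤ.+-assoc (coef t) _ acc))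
    ... | false = foldr-acc E acc

  coeffStep-skip : ∀ k m w t acc → mon t ≢ sortℤ m → coeffStep k m w t acc ≡ acc
  coeffStep-skip k m w t acc ≢m with mon t ≟L sortℤ m in ≟m
  ... | true = ⊥-elim (≢m (toWitness (subst T (sym ≟m) _)))
  ... | false rewrite Bool.∧-zeroʳ (bpow t ≡ᵇ k) = refl

  HasVar≤ : ℤ → List ℤ → Set
  HasVar≤ c l = Any (ℤ._≤ c) l

  coeff-HasVar≤ : ∀ {c} E k m w → All (HasVar≤ c ∘ mon) E → All (c ℤ.<_) (sortℤ m) → coeff E k m w ≡ + 0
  coeff-HasVar≤ [] k m w [] _ = refl
  coeff-HasVar≤ (t ∷ E) k m w (low ∷ lows) high =
    trans (coeffStep-skip k m w t _ (λ eq → low≢high low (subst (All _) (sym eq) high))) (coeff-HasVar≤ E k m w lows high)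
    where
    low≢high : ∀ {c l} → HasVar≤ c l → All (c ℤ.<_) l → ⊥
    low≢high (here a≤c) (c<a ∷ _) = ℤ.<-irrefl refl (ℤ.<-≤-trans c<a a≤c)
    low≢high (there low) (_ ∷ high) = low≢high low high

module Stabilisation (m : ℕ) where

  open Monomials
  open SignedPermutations using (base)
  open ZeroHeckeAction (suc m) using (mon-π)
  open FactorProducts (suc m)
  open Factorisation m
  open Coefficients
  open import Data.Integer as ℤ using (ℤ; +_; -[1+_]; ∣_∣)
  import Data.Integer.Properties as ℤ
  open import Data.List using (List; []; _∷_; _++_; map; concatMap; upTo)
  open import Data.List.Relation.Binary.Permutation.Propositional using (↭-sym)
  import Data.List.Relation.Binary.Permutation.Propositional.Properties as ↭
  open import Data.List.Relation.Unary.All as All using (All; []; _∷_)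
  import Data.List.Relation.Unary.All.Properties as All
  open import Data.List.Relation.Unary.Any as Any using (here)
  import Data.List.Relation.Unary.Any.Properties as Any
  open import Data.Nat as ℕ using (zero; _+_; _≤_; _<_; _≤′_; ≤′-refl; ≤′-step; z≤n; s≤s)
  import Data.Nat.Properties as ℕ
  open import Data.Product using (Σ; _×_; _,_; proj₂)
  open import Function using (_∘_)
  open import Relation.Binary.PropositionalEquality

  Low : ℤ → Term → Set
  Low c t = HasVar≤ c (mon t)

  -- Every monomial of the factor's polynomial involves some x_i with i ≤ c.
  LowFactor : ℤ → Factor → Set
  LowFactor c h = All (HasVar≤ c ∘ proj₂ ∘ proj₂) (proj₂ h)

  HasVar≤-insertAllˡ : ∀ {c} m′ l → HasVar≤ c m′ → HasVar≤ c (insertAll m′ l)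
  HasVar≤-insertAllˡ m′ l low = ↭.Any-resp-↭ (↭-sym (insertAll-↭ m′ l)) (Any.++⁺ʳ l low)

  HasVar≤-insertAllʳ : ∀ {c} m′ l → HasVar≤ c l → HasVar≤ c (insertAll m′ l)
  HasVar≤-insertAllʳ m′ l low = ↭.Any-resp-↭ (↭-sym (insertAll-↭ m′ l)) (Any.++⁺ˡ low)

  πScaled-Low : ∀ {c} s f t → Low c t → All (Low c) (πScaled s f t)
  πScaled-Low s f t low = All.map⁺ (All.tabulate λ {p} _ →
    subst (HasVar≤ _) (sym (mon-π s (scale t p))) (HasVar≤-insertAllˡ (mon t) (proj₂ (proj₂ p)) low))

  πScaled-LowFactor : ∀ {c} s f t → LowFactor c (s , f) → All (Low c) (πScaled s f t)
  πScaled-LowFactor s f t lowf = All.map⁺ (All.map (λ {p} low →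
    subst (HasVar≤ _) (sym (mon-π s (scale t p))) (HasVar≤-insertAllʳ (mon t) (proj₂ (proj₂ p)) low)) lowf)

  mulH-Low : ∀ {c} E h → All (Low c) E → All (Low c) (mulH (suc m) E h)
  mulH-Low E (s , f) lows = All.++⁺ lows (All-concatMap (πScaled s f) (λ {t} → πScaled-Low s f t) lows)

  product-Low : ∀ {c} E hs → All (Low c) E → All (Low c) (product E hs)
  product-Low E [] lows = lows
  product-Low E (h ∷ hs) lows = product-Low (mulH (suc m) E h) hs (mulH-Low E h lows)

  product-LowFactors : ∀ {c} t E hs → All (LowFactor c) hs → All (Low c) E →
    Σ Elem λ E′ → product (t ∷ E) hs ≡ t ∷ E′ × All (Low c) E′
  product-LowFactors t E [] _ lows = E , refl , lows
  product-LowFactors t E ((s , f) ∷ hs) (lowf ∷ lowfs) lows =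
    product-LowFactors t (E ++ πScaled s f t ++ concatMap (πScaled s f) E) hs lowfs
      (All.++⁺ lows (All.++⁺ (πScaled-LowFactor s f t lowf)
                             (All-concatMap (πScaled s f) (λ {u} → πScaled-Low s f u) lows)))

  coeff-absorb : ∀ {c} t pre R k mm w → All (LowFactor c) pre → All (c ℤ.<_) (sortℤ mm) →
    coeff (product (t ∷ []) (pre ++ R)) k mm w ≡ coeff (product (t ∷ []) R) k mm w
  coeff-absorb t pre R k mm w lowfs high with product-LowFactors t [] pre lowfs []
  ... | E′ , t·pre≡ , lows = begin
    C (product (t ∷ []) (pre ++ R))            ≡⟨ cong C (product-++ʳ (t ∷ []) pre R) ⟩
    C (product (product (t ∷ []) pre) R)       ≡⟨ cong (λ E → C (product E R)) t·pre≡ ⟩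
    C (product (t ∷ E′) R)                     ≡⟨ coeff-↭ k mm w (product-++ (t ∷ []) E′ R) ⟩
    C (product (t ∷ []) R ++ product E′ R)     ≡⟨ coeff-++ (product (t ∷ []) R) _ k mm w ⟩
    C (product (t ∷ []) R) ℤ.+ C (product E′ R) ≡⟨ cong (λ x → C (product (t ∷ []) R) ℤ.+ x) E′-vanishes ⟩
    C (product (t ∷ []) R) ℤ.+ + 0             ≡⟨ ℤ.+-identityʳ _ ⟩
    C (product (t ∷ []) R)                     ∎
    where
    open ≡-Reasoning
    C : Elem → ℤ
    C E = coeff E k mm w
    E′-vanishes : C (product E′ R) ≡ + 0
    E′-vanishes = coeff-HasVar≤ (product E′ R) k mm w (product-Low E′ R lows) high

  threshold : ℕ → ℤ
  threshold N = + m ℤ.+ lowest (suc N)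

  var-LowFactor : ∀ {c} s x → x ℤ.≤ c → LowFactor c (s , var x)
  var-LowFactor s x x≤c = here x≤c ∷ []

  oplus-LowFactor : ∀ {c} s a b → a ℤ.≤ c → b ℤ.≤ c → LowFactor c (s , oplus a b)
  oplus-LowFactor s a b a≤c b≤c =
    here a≤c ∷ here b≤c ∷ ↭.Any-resp-↭ (↭-sym (insertℤ-↭ a (b ∷ []))) (here a≤c) ∷ []

  hDown-LowFactors : ∀ {c} a k x → x ℤ.≤ c → All (LowFactor c) (hDown a k x)
  hDown-LowFactors a zero x x≤c = []
  hDown-LowFactors a (suc k) x x≤c = All.++⁺ (hDown-LowFactors (suc a) k x x≤c) (var-LowFactor a x x≤c ∷ [])

  Aprod-LowFactors : ∀ {c} a k y → (∀ i → i < a + k → y i ℤ.≤ c) → All (LowFactor c) (Aprod a k y)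
  Aprod-LowFactors a zero y y≤c = []
  Aprod-LowFactors a (suc k) y y≤c = All.++⁺ (hDown-LowFactors a (suc k) (y a) (y≤c a (ℕ.m<m+n a (s≤s z≤n))))
    (Aprod-LowFactors (suc a) k y (λ i i< → y≤c i (subst (i <_) (sym (ℕ.+-suc a k)) i<)))

  Y-≤ : ∀ j i → i ≤ m → Y j i ℤ.≤ + m ℤ.+ j
  Y-≤ j i i≤m = ℤ.+-monoˡ-≤ j (ℤ.+≤+ i≤m)

  leftover-LowFactors : ∀ N → All (LowFactor (threshold N)) (leftover N)
  leftover-LowFactors N = Aprod-LowFactors 1 m (Y (lowest (suc N))) (λ i i<1+m → Y-≤ (lowest (suc N)) i (ℕ.≤-pred i<1+m))

  ⊕-block-LowFactors : ∀ j is → All (_≤ m) is →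
    All (LowFactor (+ m ℤ.+ j)) (map (λ i → i , oplus (+ i ℤ.+ j) j) is)
  ⊕-block-LowFactors j is is≤m = All.map⁺ (All.map (λ {i} i≤m → oplus-LowFactor i _ j (Y-≤ j i i≤m) j≤) is≤m)
    where
    j≤ : j ℤ.≤ + m ℤ.+ j
    j≤ = subst (ℤ._≤ + m ℤ.+ j) (ℤ.+-identityˡ j) (Y-≤ j 0 z≤n)

  asc-≤ : All (_≤ m) (asc (suc m))
  asc-≤ = All.map⁺ (All.applyUpTo⁺₁ (λ t → t) m (λ t<m → t<m))

  upTo-≤ : All (_≤ m) (upTo (suc m))
  upTo-≤ = All.applyUpTo⁺₁ (λ t → t) (suc m) ℕ.≤-pred

  rhsB-block-LowFactors : ∀ N → All (LowFactor (threshold N)) (rhsB-block (lowest (suc N)))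
  rhsB-block-LowFactors N = var-LowFactor 0 j (subst (ℤ._≤ threshold N) (ℤ.+-identityˡ j) (Y-≤ j 0 z≤n))
    ∷ ⊕-block-LowFactors j (asc (suc m)) asc-≤
    where j = lowest (suc N)

  rhsC-block-LowFactors : ∀ N → All (LowFactor (threshold N)) (rhsC-block (lowest (suc N)))
  rhsC-block-LowFactors N = ⊕-block-LowFactors (lowest (suc N)) (upTo (suc m)) upTo-≤

  threshold-antitone : ∀ {N₀ N} → N₀ ≤ N → threshold N ℤ.≤ threshold N₀
  threshold-antitone N₀≤N = ℤ.+-monoʳ-≤ (+ m) (ℤ.neg-mono-≤ (ℤ.+≤+ (s≤s N₀≤N)))

  threshold-m+ : ∀ a → threshold (m + a) ≡ -[1+ a ]
  threshold-m+ a = solve 2 (λ m a → m :+ (con (+ 0) :- (con (+ 1) :+ (m :+ a))) := :- (con (+ 1) :+ a)) refl (+ m) (+ a)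
    where
    open import Data.Integer.Solver using (module +-*-Solver)
    open +-*-Solver

  eventually-above : ∀ es → Σ ℕ λ N₀ → ∀ N → N₀ ≤ N → All (threshold N ℤ.<_) es
  eventually-above [] = 0 , λ _ _ → []
  eventually-above (e ∷ es) with eventually-above es
  ... | N₁ , above = (m + ∣ e ∣) ℕ.⊔ N₁ , λ N ≤N →
    e-above N (ℕ.≤-trans (ℕ.m≤m⊔n _ N₁) ≤N) ∷ above N (ℕ.≤-trans (ℕ.m≤n⊔m _ N₁) ≤N)
    where
    -[1+∣_∣]< : ∀ e → -[1+ ∣ e ∣ ] ℤ.< e
    -[1+∣ + k ∣]< = ℤ.-<+
    -[1+∣ -[1+ k ] ∣]< = ℤ.-<- (ℕ.n<1+n k)
    e-above : ∀ N → m + ∣ e ∣ ≤ N → threshold N ℤ.< e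
    e-above N ≤N = ℤ.≤-<-trans (threshold-antitone ≤N) (subst (ℤ._< e) (sym (threshold-m+ ∣ e ∣)) (-[1+∣ e ∣]<))

  eventually-constant : ∀ (f : ℕ → ℤ) {N₀} → (∀ N → N₀ ≤ N → f (suc N) ≡ f N) → ∀ N → N₀ ≤ N → f N ≡ f N₀
  eventually-constant f {N₀} step N N₀≤N = go (ℕ.≤⇒≤′ N₀≤N)
    where
    go : ∀ {N} → N₀ ≤′ N → f N ≡ f N₀
    go ≤′-refl = refl
    go (≤′-step N₀≤′N) = trans (step _ (ℕ.≤′⇒≤ N₀≤′N)) (go N₀≤′N)

  idTerm : Term
  idTerm = term (+ 1) 0 [] (idPerm (suc m))

  Stabilises : (ℕ → List Factor) → (ℕ → List Factor) → ℕ → List ℤ → List ℤ → Set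
  Stabilises lhs rhs k mm w = Σ ℕ λ N₀ → (N : ℕ) → N₀ ≤ N →
      (coeff (product (idTerm ∷ []) (lhs N)) k mm w ≡ coeff (product (idTerm ∷ []) (lhs N₀)) k mm w)
    × (coeff (product (idTerm ∷ []) (rhs N)) k mm w ≡ coeff (product (idTerm ∷ []) (lhs N₀)) k mm w)

  stabilises : ∀ (lhs rhs : ℕ → List Factor) (block : ℤ → List Factor) →
    (∀ N → lhs N ≃ leftover N ++ rhs N) →
    (∀ N → rhs (suc N) ≡ block (lowest (suc N)) ++ rhs N) →
    (∀ N → All (LowFactor (threshold N)) (block (lowest (suc N)))) →
    ∀ k mm w → Stabilises lhs rhs k mm w
  stabilises lhs rhs block lhs≃ rhs-suc block-low k mm w with eventually-above mm
  ... | N₀ , above = N₀ , λ N N₀≤N →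
    trans (lhs≡rhs N N₀≤N) (rhs≡lhs₀ N N₀≤N) , rhs≡lhs₀ N N₀≤N
    where
    C : List Factor → ℤ
    C hs = coeff (product (idTerm ∷ []) hs) k mm w
    high : ∀ N → N₀ ≤ N → All (threshold N ℤ.<_) (sortℤ mm)
    high N N₀≤N = ↭.All-resp-↭ (↭-sym (sortℤ-↭ mm)) (above N N₀≤N)
    lhs≡rhs : ∀ N → N₀ ≤ N → C (lhs N) ≡ C (rhs N)
    lhs≡rhs N N₀≤N = trans (coeff-↭ k mm w (apply (lhs≃ N) (idTerm ∷ []) (base ∷ [])))
      (coeff-absorb idTerm (leftover N) (rhs N) k mm w (leftover-LowFactors N) (high N N₀≤N))
    rhs-stable : ∀ N → N₀ ≤ N → C (rhs N) ≡ C (rhs N₀)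
    rhs-stable = eventually-constant (C ∘ rhs) λ N N₀≤N → trans (cong C (rhs-suc N))
      (coeff-absorb idTerm (block (lowest (suc N))) (rhs N) k mm w (block-low N) (high N N₀≤N))
    rhs≡lhs₀ : ∀ N → N₀ ≤ N → C (rhs N) ≡ C (lhs N₀)
    rhs≡lhs₀ N N₀≤N = trans (rhs-stable N N₀≤N) (sym (lhs≡rhs N₀ ℕ.≤-refl))

  B-stabilises : ∀ k mm w → Stabilises lhsB-factors rhsB-factors k mm w
  B-stabilises = stabilises lhsB-factors rhsB-factors rhsB-block B-factorisation
    (λ N → cong (concatMap rhsB-block) (range-suc N)) rhsB-block-LowFactors

  C-stabilises : ∀ k mm w → Stabilises lhsC-factors rhsC-factors k mm w
  C-stabilises = stabilises lhsC-factors rhsC-factors rhsC-block C-factorisation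
    (λ N → cong (concatMap rhsC-block) (range-suc N)) rhsC-block-LowFactors

proposition3p5 : (n : ℕ) → 1 ≤ n → (k : ℕ) (m w : List ℤ) →
    (Σ ℕ λ N₀ → (N : ℕ) → N₀ ≤ N →
        (coeff (lhsB n N) k m w ≡ coeff (lhsB n N₀) k m w)
      × (coeff (rhsB n N) k m w ≡ coeff (lhsB n N₀) k m w))
    × (Σ ℕ λ N₀ → (N : ℕ) → N₀ ≤ N →
        (coeff (lhsC n N) k m w ≡ coeff (lhsC n N₀) k m w)
      × (coeff (rhsC n N) k m w ≡ coeff (lhsC n N₀) k m w))
proposition3p5 (suc m) _ k μ w = B-stabilises k μ w , C-stabilises k μ w
  where open Stabilisation m
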